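{- Let $q$ be a prime power not divisible by $2$ or $3$, let $t\in\mathbb{F}_q$ with $t\neq0,1$, let $f(x)=x^3+3x^2-4t$ and let $N_f(t)$ be the number of zeros of $f$ in $\mathbb{F}_q$. Then $$N_f(t)=1+H_q(1/3,2/3;1,1/2\,|\,t).$$
   Context: Fix a nontrivial additive character $\psi_q$ of $\mathbb{F}_q$ and a generator $\omega$ of the character group of $\mathbb{F}_q^\times$; $g(m)=\sum_{x\in\mathbb{F}_q^\times}\omega(x)^m\psi_q(x)$. For hypergeometric data defined over $\mathbb{Q}$, i.e. $\prod_j\frac{X-e^{2\pi i\alpha_j}}{X-e^{2\pi i\beta_j}}=\frac{\prod_{i=1}^r(X^{p_i}-1)}{\prod_{j=1}^s(X^{q_j}-1)}$, one defines for $t\in\mathbb{F}_q^\times$ $$H_q(\alpha,\beta|t)=\frac{(-1)^{r+s}}{1-q}\sum_{m=0}^{q-2}q^{s(m)-s(0)}\prod_ig(p_im)\prod_jg(-q_jm)\,\omega(\epsilon M^{ -1}t)^m,$$ with $M=\prod p_i^{p_i}/\prod q_j^{q_j}$, $\epsilon=(-1)^{\sum q_j}$, and $s(m)$ the multiplicity of $e^{2\pi im/(q-1)}$ as a root of $\gcd(\prod_i(X^{p_i}-1),\prod_j(X^{q_j}-1))$. Here $\alpha=(1/3,2/3)$, $\beta=(1,1/2)$, so $p=(3)$, $q=(1,2)$, $M=27/4$, $\epsilon=-1$, the gcd is $X-1$, and $s(m)=1$ if $(q-1)\mid m$ and $0$ otherwise; explicitly $H_q(1/3,2/3;1,1/2|t)=\frac{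 -1}{1-q}\sum_{m=0}^{q-2}q^{s(m)-1}g(3m)g(-m)g(-2m)\,\omega(-4t/27)^m$. -}

module Defs where

open import Level using (0ℓ)
open import Algebra.Bundles using (CommutativeRing)
open import Data.Nat using (ℕ; zero; suc; _∸_; _<_) renaming (_*_ to _*ℕ_)
open import Data.Nat.Divisibility using (_∣?_)
open import Data.Integer using (ℤ; +_; -[1+_]) renaming (_*_ to _*ℤ_; -_ to -ℤ_)
open import Data.Fin using (Fin; toℕ) renaming (zero to fzero; suc to fsuc)
open import Data.Product using (∃; _×_; _,_)
open import Relation.Nullary using (¬_; yes; no)
open import Relation.Binary using (Decidable)
open import Relation.Binary.PropositionalEquality using (_≡_)

record IsFieldOn (R : CommutativeRing 0ℓ 0ℓ) : Set where
  open CommutativeRing R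
  field
    1≉0      : ¬ (1# ≈ 0#)
    inv      : Carrier → Carrier
    inv-cong : ∀ {x y} → x ≈ y → inv x ≈ inv y
    inv-r    : ∀ x → ¬ (x ≈ 0#) → x * inv x ≈ 1#

cast : (R : CommutativeRing 0ℓ 0ℓ) → ℕ → CommutativeRing.Carrier R
cast R zero    = CommutativeRing.0# R
cast R (suc n) = CommutativeRing._+_ R (CommutativeRing.1# R) (cast R n)

pow : (R : CommutativeRing 0ℓ 0ℓ) → CommutativeRing.Carrier R → ℕ → CommutativeRing.Carrier R
pow R x zero    = CommutativeRing.1# R
pow R x (suc n) = CommutativeRing._*_ R x (pow R x n)

record FiniteField (q : ℕ) : Set₁ where
  field
    cring    : CommutativeRing 0ℓ 0ℓ
    isField  : IsFieldOn cring
  open CommutativeRing cring public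
  open IsFieldOn isField public
  field
    _≟_      : Decidable _≈_
    enum     : Fin q → Carrier
    enum-inj : ∀ i j → enum i ≈ enum j → i ≡ j
    enum-sur : ∀ x → ∃ λ i → enum i ≈ x

-- A field of characteristic zero (the target of the characters; ℂ in the paper)
record Char0Field : Set₁ where
  field
    cring   : CommutativeRing 0ℓ 0ℓ
    isField : IsFieldOn cring
  open CommutativeRing cring public
  open IsFieldOn isField public
  field
    char0   : ∀ n → ¬ (cast cring (suc n) ≈ 0#)

sumFin : {A : Set} → (A → A → A) → A → (n : ℕ) → (Fin n → A) → A
sumFin _+_ z zero    f = z
sumFin _+_ z (suc n) f = f fzero + sumFin _+_ z n (λ i → f (fsuc i))

countFin : {A : Set} {_≈_ : A → A → Set} → Decidable _≈_ → (n : ℕ) → (Fin n → A) → A → ℕ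
countFin dec zero    f a = zero
countFin dec (suc n) f a with dec (f fzero) a
... | yes _ = suc (countFin dec n (λ i → f (fsuc i)) a)
... | no  _ = countFin dec n (λ i → f (fsuc i)) a

module _ {q : ℕ} (F : FiniteField q) (K : Char0Field) where
  private
    module F = FiniteField F
    module K = Char0Field K

  record AddChar : Set where
    field
      ψ        : F.Carrier → K.Carrier
      ψ-cong   : ∀ {x y} → x F.≈ y → ψ x K.≈ ψ y
      ψ-unit   : ∀ x → ¬ (ψ x K.≈ K.0#)
      ψ-hom    : ∀ x y → ψ (x F.+ y) K.≈ ψ x K.* ψ y
      ψ-nontriv : ∃ λ x → ¬ (ψ x K.≈ K.1#)

  -- multiplicative character ω : F^× → K^× (given as a function on F whose
  -- value at 0 is irrelevant), which generates the character group of F^×,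
  -- i.e. has order exactly q-1: ω^m is nontrivial for 0 < m < q-1.
  record GenMulChar : Set where
    field
      ω        : F.Carrier → K.Carrier
      ω-cong   : ∀ {x y} → x F.≈ y → ω x K.≈ ω y
      ω-unit   : ∀ x → ¬ (x F.≈ F.0#) → ¬ (ω x K.≈ K.0#)
      ω-hom    : ∀ x y → ¬ (x F.≈ F.0#) → ¬ (y F.≈ F.0#) → ω (x F.* y) K.≈ ω x K.* ω y
      ω-gen    : ∀ m → 0 < m → m < q ∸ 1 →
                   ∃ λ x → ¬ (x F.≈ F.0#) × ¬ (pow K.cring (ω x) m K.≈ K.1#)

  powℤ : K.Carrier → ℤ → K.Carrier
  powℤ x (+ n)      = pow K.cring x n
  powℤ x -[1+ n ]   = pow K.cring (K.inv x) (suc n)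

  module _ (Ψ : AddChar) (Ω : GenMulChar) where
    open AddChar Ψ
    open GenMulChar Ω

    gauss : ℤ → K.Carrier
    gauss m = sumFin K._+_ K.0# q term
      where
        term : Fin q → K.Carrier
        term i with F._≟_ (F.enum i) F.0#
        ... | yes _ = K.0#
        ... | no  _ = powℤ (ω (F.enum i)) m K.* ψ (F.enum i)

    -- q^{s(m)-s(0)} with s(m) = 1 if (q-1) ∣ m and 0 otherwise (s(0) = 1)
    qPowS : ℕ → K.Carrier
    qPowS m with (q ∸ 1) ∣? m
    ... | yes _ = K.1#
    ... | no  _ = K.inv (cast K.cring q)

    -- H_q(1/3,2/3;1,1/2 | t)
    --  = (-1)^{r+s}/(1-q) Σ_{m=0}^{q-2} q^{s(m)-s(0)} g(3m) g(-m) g(-2m) ω(ε M^{-1} t)^m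
    -- with r = 1, s = 2, M = 27/4, ε = -1.
    Hq : F.Carrier → K.Carrier
    Hq t = (pow K.cring (K.- K.1#) 3 K.* K.inv (K.1# K.- cast K.cring q))
           K.* sumFin K._+_ K.0# (q ∸ 1) summand
      where
        arg : F.Carrier
        arg = ((F.- F.1#) F.* (cast F.cring 4 F.* F.inv (cast F.cring 27))) F.* t
        summand : Fin (q ∸ 1) → K.Carrier
        summand i = let m = toℕ i in
          qPowS m K.* gauss (+ (3 *ℕ m)) K.* gauss (-ℤ (+ m))
                  K.* gauss (-ℤ (+ (2 *ℕ m))) K.* pow K.cring (ω arg) m

Nf : {q : ℕ} (F : FiniteField q) → FiniteField.Carrier F → ℕ
Nf {q} F t = countFin F._≟_ q (λ i → f (F.enum i)) F.0#
  where
    module F = FiniteField F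
    f : F.Carrier → F.Carrier
    f x = (pow F.cring x 3 F.+ (cast F.cring 3 F.* pow F.cring x 2)) F.- (cast F.cring 4 F.* t)

{-# OPTIONS --safe #-}
module Submission where

open import Level using (0ℓ)
open import Algebra.Bundles using (CommutativeMonoid; CommutativeRing)
open import Data.Bool using (if_then_else_)
open import Data.Empty using (⊥; ⊥-elim)
open import Data.Fin.Properties using (toℕ<n)
open import Data.Fin using (Fin; toℕ) renaming (zero to fzero; suc to fsuc)
open import Data.Fin.Permutation using (Permutation; _⟨$⟩ʳ_; permutation)
open import Data.Nat using (ℕ; zero; suc; _<_; s≤s; z≤n) renaming (_+_ to _+ℕ_; _*_ to _*ℕ_)
import Data.Nat.Properties as ℕ
open import Data.Nat.Coprimality using (Coprime; coprime-Bézout)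
open import Data.Nat.Divisibility using (_∣_; _∣?_; _∣0; ∣⇒≤)
open import Data.Nat.GCD using (module Bézout)
open import Data.Nat.Primality using (Prime; prime?; prime[2]; prime⇒irreducible)
open import Data.Integer using (ℤ; +_) renaming (-_ to -ℤ_)
open import Data.Product using (∃; _,_; proj₁; proj₂)
open import Data.Sum using (_⊎_; inj₁; inj₂)
open import Relation.Nullary using (¬_; Dec; does; yes; no)
open import Relation.Nullary.Decidable using (from-yes; ¬¬-excluded-middle)
open import Relation.Binary.Bundles using (Setoid)
open import Relation.Binary.PropositionalEquality as P using (_≡_)
open import Defs

-- Expanding the three Gauss sums, the m-th term of H_q becomes a sum over x, y, z ∈ F^× of
-- ω(c x³ / (y z²))^m ψ(x + y + z), where c = -4t/27. Since ω generates the character group,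
-- Σ_{m < q-1} ω(r)^m is q - 1 for r = 1 and 0 otherwise, which forces y = c x³ / z².
-- Substituting x = z u turns the argument of ψ into z (1 + u + c u³); summing ψ over z ∈ F^×
-- gives q - 1 at the roots u of 1 + u + c u³ and -1 elsewhere, and u ↦ 3/u matches these roots
-- with the (nonzero) roots of x³ + 3x² - 4t. What remains is algebra in q and N_f(t).

infix 0 ifᵈ_then_else_
ifᵈ_then_else_ : {A : Set} {P : Set} → Dec P → A → A → A
ifᵈ d then a else b = if does d then a else b

module _ (S : Setoid 0ℓ 0ℓ) where
  open Setoid S

  ifᵈ-cong : ∀ {P Q : Set} (d : Dec P) (e : Dec Q) → (P → Q) → (Q → P) →
    ∀ {a a′ b b′} → a ≈ a′ → b ≈ b′ → (ifᵈ d then a else b) ≈ (ifᵈ e then a′ else b′)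
  ifᵈ-cong (yes _) (yes _) _   _   a≈a′ _    = a≈a′
  ifᵈ-cong (yes p) (no ¬q) p⇒q _   _    _    = ⊥-elim (¬q (p⇒q p))
  ifᵈ-cong (no ¬p) (yes q) _   q⇒p _    _    = ⊥-elim (¬p (q⇒p q))
  ifᵈ-cong (no _)  (no _)  _   _   _    b≈b′ = b≈b′

module CommutativeRingProperties (R : CommutativeRing 0ℓ 0ℓ) where
  open CommutativeRing R
  open import Algebra.Properties.Ring ring public
  import Algebra.Properties.Group +-group as +-Group
  open import Algebra.Solver.Ring.NaturalCoefficients.Default commutativeSemiring public
  open import Relation.Binary.Reasoning.Setoid setoid

  x≈y+z⇒x-z≈y : ∀ {x y z} → x ≈ y + z → x - z ≈ y
  x≈y+z⇒x-z≈y {x} {y} {z} x≈y+z = begin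
    x - z        ≈⟨ +-congʳ x≈y+z ⟩
    (y + z) - z  ≈⟨ +-assoc _ _ _ ⟩
    y + (z - z)  ≈⟨ +-congˡ (-‿inverseʳ z) ⟩
    y + 0#       ≈⟨ +-identityʳ y ⟩
    y            ∎

  x-z≈y⇒x≈y+z : ∀ {x y z} → x - z ≈ y → x ≈ y + z
  x-z≈y⇒x≈y+z {x} {y} {z} x-z≈y = begin
    x             ≈⟨ sym (+-identityʳ x) ⟩
    x + 0#        ≈⟨ +-congˡ (sym (-‿inverseˡ z)) ⟩
    x + (- z + z) ≈⟨ sym (+-assoc _ _ _) ⟩
    (x - z) + z   ≈⟨ +-congʳ x-z≈y ⟩
    y + z         ∎

  x+y≈x⇒y≈0 : ∀ {x y} → x + y ≈ x → y ≈ 0#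
  x+y≈x⇒y≈0 {x} {y} x+y≈x = +-cancelˡ x y 0# (trans x+y≈x (sym (+-identityʳ x)))

  x+y≈0⇒y≈-x : ∀ {x y} → x + y ≈ 0# → y ≈ - x
  x+y≈0⇒y≈-x {x} {y} = +-Group.inverseʳ-unique x y

  cast-+ : ∀ a b → cast R (a +ℕ b) ≈ cast R a + cast R b
  cast-+ zero    b = sym (+-identityˡ _)
  cast-+ (suc a) b = trans (+-congˡ (cast-+ a b)) (sym (+-assoc _ _ _))

  cast-* : ∀ a b → cast R (a *ℕ b) ≈ cast R a * cast R b
  cast-* zero    b = sym (zeroˡ _)
  cast-* (suc a) b = begin
    cast R (b +ℕ a *ℕ b)                  ≈⟨ cast-+ b (a *ℕ b) ⟩
    cast R b + cast R (a *ℕ b)            ≈⟨ +-congˡ (cast-* a b) ⟩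
    cast R b + cast R a * cast R b        ≈⟨ +-congʳ (sym (*-identityˡ _)) ⟩
    1# * cast R b + cast R a * cast R b   ≈⟨ sym (distribʳ _ _ _) ⟩
    (1# + cast R a) * cast R b            ∎

  cast-multiple≈0 : ∀ k {n} → cast R n ≈ 0# → cast R (k *ℕ n) ≈ 0#
  cast-multiple≈0 k n≈0 = trans (cast-* k _) (trans (*-congˡ n≈0) (zeroʳ _))

  pow-cong : ∀ {x y} n → x ≈ y → pow R x n ≈ pow R y n
  pow-cong zero    x≈y = refl
  pow-cong (suc n) x≈y = *-cong x≈y (pow-cong n x≈y)

  pow-+ : ∀ x a b → pow R x (a +ℕ b) ≈ pow R x a * pow R x b
  pow-+ x zero    b = sym (*-identityˡ _)
  pow-+ x (suc a) b = trans (*-congˡ (pow-+ x a b)) (sym (*-assoc _ _ _))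

  pow-pow : ∀ x a b → pow R (pow R x a) b ≈ pow R x (a *ℕ b)
  pow-pow x a zero    = reflexive (P.cong (pow R x) (P.sym (ℕ.*-zeroʳ a)))
  pow-pow x a (suc b) = begin
    pow R x a * pow R (pow R x a) b ≈⟨ *-congˡ (pow-pow x a b) ⟩
    pow R x a * pow R x (a *ℕ b)    ≈⟨ sym (pow-+ x a (a *ℕ b)) ⟩
    pow R x (a +ℕ a *ℕ b)           ≡⟨ P.cong (pow R x) (P.sym (ℕ.*-suc a b)) ⟩
    pow R x (a *ℕ suc b)            ∎

  pow-distrib-* : ∀ x y n → pow R (x * y) n ≈ pow R x n * pow R y n
  pow-distrib-* x y zero    = sym (*-identityˡ _)
  pow-distrib-* x y (suc n) = trans (*-congˡ (pow-distrib-* x y n))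
    (solve 4 (λ a b c d → (a :* b) :* (c :* d) := (a :* c) :* (b :* d)) refl x y (pow R x n) (pow R y n))

  pow-1# : ∀ n → pow R 1# n ≈ 1#
  pow-1# zero    = refl
  pow-1# (suc n) = trans (*-identityˡ _) (pow-1# n)

module FieldProperties (R : CommutativeRing 0ℓ 0ℓ) (isField : IsFieldOn R) where
  open CommutativeRing R
  open IsFieldOn isField
  open CommutativeRingProperties R public
  import Algebra.Properties.Group +-group as +-Group
  open import Relation.Binary.Reasoning.Setoid setoid

  inverseˡ : ∀ x → ¬ (x ≈ 0#) → inv x * x ≈ 1#
  inverseˡ x x≉0 = trans (*-comm _ _) (inv-r x x≉0)

  *-cancelˡ : ∀ {a x y} → ¬ (a ≈ 0#) → a * x ≈ a * y → x ≈ y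
  *-cancelˡ {a} {x} {y} a≉0 ax≈ay = begin
    x               ≈⟨ sym (*-identityˡ x) ⟩
    1# * x          ≈⟨ *-congʳ (sym (inverseˡ a a≉0)) ⟩
    (inv a * a) * x ≈⟨ *-assoc _ _ _ ⟩
    inv a * (a * x) ≈⟨ *-congˡ ax≈ay ⟩
    inv a * (a * y) ≈⟨ sym (*-assoc _ _ _) ⟩
    (inv a * a) * y ≈⟨ *-congʳ (inverseˡ a a≉0) ⟩
    1# * y          ≈⟨ *-identityˡ y ⟩
    y               ∎

  x≉0∧x*y≈0⇒y≈0 : ∀ {x y} → ¬ (x ≈ 0#) → x * y ≈ 0# → y ≈ 0#
  x≉0∧x*y≈0⇒y≈0 x≉0 xy≈0 = *-cancelˡ x≉0 (trans xy≈0 (sym (zeroʳ _)))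

  *-nonzero : ∀ {x y} → ¬ (x ≈ 0#) → ¬ (y ≈ 0#) → ¬ (x * y ≈ 0#)
  *-nonzero x≉0 y≉0 xy≈0 = y≉0 (x≉0∧x*y≈0⇒y≈0 x≉0 xy≈0)

  inv-nonzero : ∀ {x} → ¬ (x ≈ 0#) → ¬ (inv x ≈ 0#)
  inv-nonzero {x} x≉0 x⁻¹≈0 = 1≉0 (trans (sym (inv-r x x≉0)) (trans (*-congˡ x⁻¹≈0) (zeroʳ _)))

  inv-unique : ∀ {x y} → ¬ (x ≈ 0#) → x * y ≈ 1# → y ≈ inv x
  inv-unique {x} x≉0 xy≈1 = *-cancelˡ x≉0 (trans xy≈1 (sym (inv-r x x≉0)))

  idempotent⇒1# : ∀ {x} → ¬ (x ≈ 0#) → x * x ≈ x → x ≈ 1#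
  idempotent⇒1# {x} x≉0 xx≈x = *-cancelˡ x≉0 (trans xx≈x (sym (*-identityʳ x)))

  fixedBy≉1⇒0# : ∀ {z w} → ¬ (z ≈ 1#) → z * w ≈ w → w ≈ 0#
  fixedBy≉1⇒0# {z} {w} z≉1 zw≈w = x≉0∧x*y≈0⇒y≈0 (λ z-1≈0 → z≉1 (+-Group.x∙y⁻¹≈ε⇒x≈y z 1# z-1≈0)) (begin
    (z - 1#) * w         ≈⟨ distribʳ _ _ _ ⟩
    z * w + (- 1#) * w   ≈⟨ +-cong zw≈w (-1*x≈-x w) ⟩
    w - w                ≈⟨ -‿inverseʳ w ⟩
    0#                   ∎)

  -1#≉0 : ¬ (- 1# ≈ 0#)
  -1#≉0 -1≈0 = 1≉0 (trans (sym (-‿involutive 1#)) (trans (-‿cong -1≈0) -0#≈0#))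

  unit-combination≉0 : ∀ {m n} → cast R m ≈ 0# → cast R n ≈ 0# → ∀ a b → ¬ (1 +ℕ a *ℕ m ≡ b *ℕ n)
  unit-combination≉0 {m} {n} m≈0 n≈0 a b 1+am≡bn = 1≉0 (begin
    1#                    ≈⟨ sym (+-identityʳ 1#) ⟩
    1# + 0#               ≈⟨ +-congˡ (sym (cast-multiple≈0 a m≈0)) ⟩
    cast R (1 +ℕ a *ℕ m)  ≡⟨ P.cong (cast R) 1+am≡bn ⟩
    cast R (b *ℕ n)       ≈⟨ cast-multiple≈0 b n≈0 ⟩
    0#                    ∎)

  coprime-to-characteristic : ∀ {p q} → cast R q ≈ 0# → Coprime p q → ¬ (cast R p ≈ 0#)
  coprime-to-characteristic q≈0 coprime p≈0 with coprime-Bézout coprime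
  ... | Bézout.+- x y 1+yq≡xp = unit-combination≉0 q≈0 p≈0 y x 1+yq≡xp
  ... | Bézout.-+ x y 1+xp≡yq = unit-combination≉0 p≈0 q≈0 x y 1+xp≡yq

  pow-nonzero : ∀ {x} n → ¬ (x ≈ 0#) → ¬ (pow R x n ≈ 0#)
  pow-nonzero zero    x≉0 = 1≉0
  pow-nonzero (suc n) x≉0 = *-nonzero x≉0 (pow-nonzero n x≉0)

module FinSum (M : CommutativeMonoid 0ℓ 0ℓ) where
  open CommutativeMonoid M
  import Algebra.Properties.CommutativeMonoid.Sum M as S
  open import Algebra.Definitions.RawMonoid rawMonoid using (_×_) public
  open import Relation.Binary.Reasoning.Setoid setoid

  Σ : (n : ℕ) → (Fin n → Carrier) → Carrier
  Σ = sumFin _∙_ ε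

  Σ≡sum : ∀ n f → Σ n f ≡ S.sum {n} f
  Σ≡sum zero    f = P.refl
  Σ≡sum (suc n) f = P.cong (f fzero ∙_) (Σ≡sum n (λ i → f (fsuc i)))

  Σ-cong : ∀ n {f g : Fin n → Carrier} → (∀ i → f i ≈ g i) → Σ n f ≈ Σ n g
  Σ-cong zero    f≈g = refl
  Σ-cong (suc n) f≈g = ∙-cong (f≈g fzero) (Σ-cong n (λ i → f≈g (fsuc i)))

  Σ-distrib : ∀ n (f g : Fin n → Carrier) → Σ n (λ i → f i ∙ g i) ≈ Σ n f ∙ Σ n g
  Σ-distrib n f g = begin
    Σ n (λ i → f i ∙ g i)  ≡⟨ Σ≡sum n _ ⟩
    S.sum (λ i → f i ∙ g i) ≈⟨ S.∑-distrib-+ f g ⟩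
    S.sum f ∙ S.sum g       ≡⟨ P.sym (P.cong₂ _∙_ (Σ≡sum n f) (Σ≡sum n g)) ⟩
    Σ n f ∙ Σ n g           ∎

  Σ-const : ∀ n c → Σ n (λ _ → c) ≈ n × c
  Σ-const n c = trans (reflexive (Σ≡sum n _)) (S.sum-replicate n)

  Σ-ε : ∀ n → Σ n (λ _ → ε) ≈ ε
  Σ-ε zero    = refl
  Σ-ε (suc n) = trans (identityˡ _) (Σ-ε n)

  Σ-swap : ∀ m n (f : Fin m → Fin n → Carrier) →
    Σ m (λ i → Σ n (f i)) ≈ Σ n (λ j → Σ m (λ i → f i j))
  Σ-swap m n f = begin
    Σ m (λ i → Σ n (f i))             ≡⟨ Σ≡sum m _ ⟩
    S.sum (λ i → Σ n (f i))           ≡⟨ S.sum-cong-≗ {m} (λ i → Σ≡sum n (f i)) ⟩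
    S.sum (λ i → S.sum (f i))         ≈⟨ S.∑-comm f ⟩
    S.sum (λ j → S.sum (λ i → f i j)) ≡⟨ S.sum-cong-≗ {n} (λ j → P.sym (Σ≡sum m (λ i → f i j))) ⟩
    S.sum (λ j → Σ m (λ i → f i j))   ≡⟨ P.sym (Σ≡sum n _) ⟩
    Σ n (λ j → Σ m (λ i → f i j))     ∎

  Σ-permute : ∀ n (f : Fin n → Carrier) (π : Permutation n n) → Σ n f ≈ Σ n (λ i → f (π ⟨$⟩ʳ i))
  Σ-permute n f π = begin
    Σ n f                      ≡⟨ Σ≡sum n f ⟩
    S.sum f                    ≈⟨ S.sum-permute f π ⟩
    S.sum (λ i → f (π ⟨$⟩ʳ i)) ≡⟨ P.sym (Σ≡sum n _) ⟩
    Σ n (λ i → f (π ⟨$⟩ʳ i))   ∎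

  Σ-ifᵈ : ∀ {P : Set} (d : Dec P) n (f : Fin n → Carrier) →
    Σ n (λ i → ifᵈ d then ε else f i) ≈ (ifᵈ d then ε else Σ n f)
  Σ-ifᵈ (yes _) n f = Σ-ε n
  Σ-ifᵈ (no _)  n f = refl

  module OverField {m : ℕ} (F : FiniteField (suc m)) where
    private
      module F = FiniteField F
      module FP = FieldProperties F.cring F.isField
    open import Algebra.Properties.CommutativeSemigroup commutativeSemigroup using (x∙yz≈y∙xz)

    ΣF : (F.Carrier → Carrier) → Carrier
    ΣF f = Σ (suc m) (λ i → f (F.enum i))

    Respects≈ : (F.Carrier → Carrier) → Set
    Respects≈ f = ∀ {x y} → x F.≈ y → f x ≈ f y

    ΣF-cong : ∀ {f g} → (∀ x → f x ≈ g x) → ΣF f ≈ ΣF g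
    ΣF-cong f≈g = Σ-cong (suc m) (λ i → f≈g (F.enum i))

    indexOf : F.Carrier → Fin (suc m)
    indexOf x = proj₁ (F.enum-sur x)

    enum-indexOf : ∀ x → F.enum (indexOf x) F.≈ x
    enum-indexOf x = proj₂ (F.enum-sur x)

    ΣF-bijection : (σ τ : F.Carrier → F.Carrier) →
      (∀ {x y} → x F.≈ y → σ x F.≈ σ y) → (∀ {x y} → x F.≈ y → τ x F.≈ τ y) →
      (∀ x → σ (τ x) F.≈ x) → (∀ x → τ (σ x) F.≈ x) →
      (f : F.Carrier → Carrier) → Respects≈ f → ΣF f ≈ ΣF (λ x → f (σ x))
    ΣF-bijection σ τ σ-cong τ-cong στ τσ f f-cong = begin
      ΣF f                                 ≈⟨ Σ-permute (suc m) (λ i → f (F.enum i)) π ⟩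
      Σ (suc m) (λ i → f (F.enum (to i))) ≈⟨ Σ-cong (suc m) (λ i → f-cong (enum-indexOf (σ (F.enum i)))) ⟩
      ΣF (λ x → f (σ x))                   ∎
      where
      to from : Fin (suc m) → Fin (suc m)
      to   i = indexOf (σ (F.enum i))
      from i = indexOf (τ (F.enum i))
      π : Permutation (suc m) (suc m)
      π = permutation to from
        (λ i → F.enum-inj _ _ (F.trans (enum-indexOf _) (F.trans (σ-cong (enum-indexOf _)) (στ _))))
        (λ i → F.enum-inj _ _ (F.trans (enum-indexOf _) (F.trans (τ-cong (enum-indexOf _)) (τσ _))))

    ΣF-translate : ∀ b (f : F.Carrier → Carrier) → Respects≈ f → ΣF f ≈ ΣF (λ x → f (x F.+ b))
    ΣF-translate b = ΣF-bijection (F._+ b) (F._- b) F.+-congʳ F.+-congʳ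
      (λ x → F.sym (FP.x-z≈y⇒x≈y+z F.refl)) (λ x → FP.x≈y+z⇒x-z≈y F.refl)

    ΣF-dilate : ∀ {a} → ¬ (a F.≈ F.0#) → (f : F.Carrier → Carrier) → Respects≈ f → ΣF f ≈ ΣF (λ x → f (a F.* x))
    ΣF-dilate {a} a≉0 = ΣF-bijection (a F.*_) (F.inv a F.*_) F.*-congˡ F.*-congˡ
      (cancel (F.inv-r a a≉0)) (cancel (FP.inverseˡ a a≉0))
      where
      cancel : ∀ {b c} → b F.* c F.≈ F.1# → ∀ x → b F.* (c F.* x) F.≈ x
      cancel bc≈1 x = F.trans (F.sym (F.*-assoc _ _ _)) (F.trans (F.*-congʳ bc≈1) (F.*-identityˡ x))

    Σ-hitOnce : ∀ k (e : Fin (suc k) → F.Carrier) → (∀ i j → e i F.≈ e j → i ≡ j) →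
      ∀ v i₀ → e i₀ F.≈ v → ∀ a b →
      Σ (suc k) (λ i → ifᵈ e i F.≟ v then a else b) ≈ a ∙ k × b
    Σ-hitOnce k e inj v i₀ eᵢ₀≈v a b with e fzero F.≟ v
    ... | yes e₀≈v = ∙-congˡ (trans (Σ-cong k missed) (Σ-const k b))
      where
      missed : ∀ i → (ifᵈ e (fsuc i) F.≟ v then a else b) ≈ b
      missed i with e (fsuc i) F.≟ v
      ... | yes eᵢ≈v with () ← inj _ _ (F.trans eᵢ≈v (F.sym e₀≈v))
      ... | no _ = refl
    Σ-hitOnce k e inj v fzero eᵢ₀≈v a b | no e₀≉v = ⊥-elim (e₀≉v eᵢ₀≈v)
    Σ-hitOnce (suc k) e inj v (fsuc j) eᵢ₀≈v a b | no _ =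
      trans (∙-congˡ (Σ-hitOnce k (λ i → e (fsuc i)) (λ i j eq → fsuc-injective (inj _ _ eq)) v j eᵢ₀≈v a b))
            (x∙yz≈y∙xz b a (k × b))
      where
      fsuc-injective : ∀ {n} {i j : Fin n} → fsuc i ≡ fsuc j → i ≡ j
      fsuc-injective P.refl = P.refl

    ΣF-hitOnce : ∀ v a b → ΣF (λ x → ifᵈ x F.≟ v then a else b) ≈ a ∙ m × b
    ΣF-hitOnce v = Σ-hitOnce m F.enum F.enum-inj v (indexOf v) (enum-indexOf v)

    ΣF-indicator : ∀ v c → ΣF (λ x → ifᵈ x F.≟ v then c else ε) ≈ c
    ΣF-indicator v c = trans (ΣF-hitOnce v c ε) (trans (∙-congˡ (trans (sym (Σ-const m ε)) (Σ-ε m))) (identityʳ c))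

    ΣF-splitAt : ∀ v (f : F.Carrier → Carrier) → Respects≈ f →
      ΣF f ≈ f v ∙ ΣF (λ x → ifᵈ x F.≟ v then ε else f x)
    ΣF-splitAt v f f-cong = begin
      ΣF f                                                                   ≈⟨ ΣF-cong split ⟩
      ΣF (λ x → (ifᵈ x F.≟ v then f v else ε) ∙ (ifᵈ x F.≟ v then ε else f x))
        ≈⟨ Σ-distrib (suc m) (λ i → ifᵈ F.enum i F.≟ v then f v else ε) (λ i → ifᵈ F.enum i F.≟ v then ε else f (F.enum i)) ⟩
      ΣF (λ x → ifᵈ x F.≟ v then f v else ε) ∙ ΣF (λ x → ifᵈ x F.≟ v then ε else f x)
        ≈⟨ ∙-congʳ (ΣF-indicator v (f v)) ⟩
      f v ∙ ΣF (λ x → ifᵈ x F.≟ v then ε else f x)                            ∎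
      where
      split : ∀ x → f x ≈ (ifᵈ x F.≟ v then f v else ε) ∙ (ifᵈ x F.≟ v then ε else f x)
      split x with x F.≟ v
      ... | yes x≈v = trans (f-cong x≈v) (sym (identityʳ _))
      ... | no  _   = sym (identityˡ _)

    ifᵈ≟-cong : ∀ {v x y} → x F.≈ y → ∀ {a a′ b b′} → a ≈ a′ → b ≈ b′ →
      (ifᵈ x F.≟ v then a else b) ≈ (ifᵈ y F.≟ v then a′ else b′)
    ifᵈ≟-cong x≈y = ifᵈ-cong setoid (_ F.≟ _) (_ F.≟ _) (F.trans (F.sym x≈y)) (F.trans x≈y)

    onUnits : (F.Carrier → Carrier) → F.Carrier → Carrier
    onUnits f x = ifᵈ x F.≟ F.0# then ε else f x

    onUnits-cong : ∀ {f} → Respects≈ f → Respects≈ (onUnits f)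
    onUnits-cong f-cong x≈y = ifᵈ≟-cong x≈y refl (f-cong x≈y)

    ΣF× : (F.Carrier → Carrier) → Carrier
    ΣF× f = ΣF (onUnits f)

    ΣF×-cong : ∀ {f g} → (∀ x → ¬ (x F.≈ F.0#) → f x ≈ g x) → ΣF× f ≈ ΣF× g
    ΣF×-cong {f} {g} f≈g = ΣF-cong pointwise
      where
      pointwise : ∀ x → onUnits f x ≈ onUnits g x
      pointwise x with x F.≟ F.0#
      ... | yes _   = refl
      ... | no  x≉0 = f≈g x x≉0

    ΣF×-dilate : ∀ {a} → ¬ (a F.≈ F.0#) → (f : F.Carrier → Carrier) → Respects≈ f →
      ΣF× f ≈ ΣF× (λ x → f (a F.* x))
    ΣF×-dilate {a} a≉0 f f-cong = trans (ΣF-dilate a≉0 (onUnits f) (onUnits-cong f-cong)) (ΣF-cong dilated)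
      where
      dilated : ∀ x → onUnits f (a F.* x) ≈ onUnits (λ y → f (a F.* y)) x
      dilated x = ifᵈ-cong setoid (_ F.≟ F.0#) (_ F.≟ F.0#)
        (FP.x≉0∧x*y≈0⇒y≈0 a≉0) (λ x≈0 → F.trans (F.*-congˡ x≈0) (F.zeroʳ a)) refl refl

    ΣF×-distrib : ∀ f g → ΣF× (λ x → f x ∙ g x) ≈ ΣF× f ∙ ΣF× g
    ΣF×-distrib f g = trans (ΣF-cong pointwise)
      (Σ-distrib (suc m) (λ i → onUnits f (F.enum i)) (λ i → onUnits g (F.enum i)))
      where
      pointwise : ∀ x → onUnits (λ y → f y ∙ g y) x ≈ onUnits f x ∙ onUnits g x
      pointwise x with x F.≟ F.0#
      ... | yes _ = sym (identityˡ ε)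
      ... | no  _ = refl

    ΣF×-involution : (σ : F.Carrier → F.Carrier) → (∀ {x y} → x F.≈ y → σ x F.≈ σ y) →
      (∀ x → ¬ (x F.≈ F.0#) → ¬ (σ x F.≈ F.0#)) → (∀ x → ¬ (x F.≈ F.0#) → σ (σ x) F.≈ x) →
      (f : F.Carrier → Carrier) → Respects≈ f → ΣF× f ≈ ΣF× (λ x → f (σ x))
    ΣF×-involution σ σ-cong σ-nonzero σσ f f-cong =
      trans (ΣF-bijection σ₀ σ₀ σ₀-cong σ₀-cong σ₀σ₀ σ₀σ₀ (onUnits f) (onUnits-cong f-cong)) (ΣF-cong pointwise)
      where
      -- σ 0# is junk (think σ x = 1/x); resetting it makes σ₀ an involution of all of F.
      σ₀ : F.Carrier → F.Carrier
      σ₀ x = ifᵈ x F.≟ F.0# then F.0# else σ x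
      σ₀-cong : ∀ {x y} → x F.≈ y → σ₀ x F.≈ σ₀ y
      σ₀-cong x≈y = ifᵈ-cong F.setoid (_ F.≟ F.0#) (_ F.≟ F.0#)
        (F.trans (F.sym x≈y)) (F.trans x≈y) F.refl (σ-cong x≈y)
      σ₀-0 : σ₀ F.0# F.≈ F.0#
      σ₀-0 with F.0# F.≟ F.0#
      ... | yes _   = F.refl
      ... | no  0≉0 = ⊥-elim (0≉0 F.refl)
      σ₀σ₀ : ∀ x → σ₀ (σ₀ x) F.≈ x
      σ₀σ₀ x with x F.≟ F.0#
      ... | yes x≈0 = F.trans σ₀-0 (F.sym x≈0)
      ... | no  x≉0 with σ x F.≟ F.0#
      ...   | yes σx≈0 = ⊥-elim (σ-nonzero x x≉0 σx≈0)
      ...   | no  _    = σσ x x≉0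
      pointwise : ∀ x → onUnits f (σ₀ x) ≈ onUnits (λ y → f (σ y)) x
      pointwise x with x F.≟ F.0#
      ... | yes _   = onUnits-zero F.refl
        where
        onUnits-zero : ∀ {y} → y F.≈ F.0# → onUnits f y ≈ ε
        onUnits-zero {y} y≈0 with y F.≟ F.0#
        ... | yes _   = refl
        ... | no  y≉0 = ⊥-elim (y≉0 y≈0)
      ... | no  x≉0 with σ x F.≟ F.0#
      ...   | yes σx≈0 = ⊥-elim (σ-nonzero x x≉0 σx≈0)
      ...   | no  _    = refl

module RingSums (R : CommutativeRing 0ℓ 0ℓ) where
  open CommutativeRing R
  open FinSum +-commutativeMonoid public
  import Algebra.Properties.Semiring.Sum semiring as S
  open CommutativeRingProperties R

  *-distribˡ-Σ : ∀ n c (f : Fin n → Carrier) → c * Σ n f ≈ Σ n (λ i → c * f i)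
  *-distribˡ-Σ n c f = trans (*-congˡ (reflexive (Σ≡sum n f)))
    (trans (S.*-distribˡ-sum c f) (reflexive (P.sym (Σ≡sum n _))))

  *-distribʳ-Σ : ∀ n c (f : Fin n → Carrier) → Σ n f * c ≈ Σ n (λ i → f i * c)
  *-distribʳ-Σ n c f = trans (*-congʳ (reflexive (Σ≡sum n f)))
    (trans (S.*-distribʳ-sum c f) (reflexive (P.sym (Σ≡sum n _))))

  ×1#≈cast : ∀ k → k × 1# ≈ cast R k
  ×1#≈cast zero    = refl
  ×1#≈cast (suc k) = +-congˡ (×1#≈cast k)

  Σ-01-valued : ∀ n (f : Fin n → Carrier) → (∀ i → (f i ≈ 0#) ⊎ (f i ≈ 1#)) → ∃ λ k → Σ n f ≈ cast R k
  Σ-01-valued zero    f f01 = 0 , refl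
  Σ-01-valued (suc n) f f01 with Σ-01-valued n (λ i → f (fsuc i)) (λ i → f01 (fsuc i)) | f01 fzero
  ... | k , Σ≈k | inj₁ f₀≈0 = k     , trans (+-cong f₀≈0 Σ≈k) (+-identityˡ _)
  ... | k , Σ≈k | inj₂ f₀≈1 = suc k , +-cong f₀≈1 Σ≈k

  cast-countFin : ∀ {m} (F : FiniteField m) k (e : Fin k → FiniteField.Carrier F) →
    cast R (countFin (FiniteField._≟_ F) k e (FiniteField.0# F))
      ≈ Σ k (λ i → ifᵈ FiniteField._≟_ F (e i) (FiniteField.0# F) then 1# else 0#)
  cast-countFin F zero    e = refl
  cast-countFin F (suc k) e with FiniteField._≟_ F (e fzero) (FiniteField.0# F)
  ... | yes _ = +-congˡ (cast-countFin F k (λ i → e (fsuc i)))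
  ... | no  _ = trans (cast-countFin F k (λ i → e (fsuc i))) (sym (+-identityˡ _))

  geometric : Carrier → ℕ → Carrier
  geometric z k = Σ k (λ i → pow R z (toℕ i))

  geometric-sucˡ : ∀ z k → geometric z (suc k) ≈ 1# + z * geometric z k
  geometric-sucˡ z k = +-congˡ (sym (*-distribˡ-Σ k z (λ i → pow R z (toℕ i))))

  geometric-sucʳ : ∀ z k → geometric z (suc k) ≈ geometric z k + pow R z k
  geometric-sucʳ z zero    = trans (+-identityʳ _) (sym (+-identityˡ _))
  geometric-sucʳ z (suc k) = begin
    geometric z (suc (suc k))                   ≈⟨ geometric-sucˡ z (suc k) ⟩
    1# + z * geometric z (suc k)                ≈⟨ +-congˡ (*-congˡ (geometric-sucʳ z k)) ⟩
    1# + z * (geometric z k + pow R z k)        ≈⟨ solve 3 (λ a b c → con 1 :+ a :* (b :+ c) := (con 1 :+ a :* b) :+ a :* c)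
                                                          refl z (geometric z k) (pow R z k) ⟩
    (1# + z * geometric z k) + z * pow R z k    ≈⟨ +-congʳ (sym (geometric-sucˡ z k)) ⟩
    geometric z (suc k) + pow R z (suc k)       ∎
    where open import Relation.Binary.Reasoning.Setoid setoid

  geometric-fixed : ∀ z k → pow R z k ≈ 1# → z * geometric z k ≈ geometric z k
  geometric-fixed z k zᵏ≈1 = +-cancelʳ 1# (z * geometric z k) (geometric z k) (begin
    z * geometric z k + 1#       ≈⟨ +-comm _ _ ⟩
    1# + z * geometric z k       ≈⟨ sym (geometric-sucˡ z k) ⟩
    geometric z (suc k)          ≈⟨ geometric-sucʳ z k ⟩
    geometric z k + pow R z k    ≈⟨ +-congˡ zᵏ≈1 ⟩
    geometric z k + 1#           ∎)
    where open import Relation.Binary.Reasoning.Setoid setoid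

  geometric-1 : ∀ z k → z ≈ 1# → geometric z k ≈ cast R k
  geometric-1 z k z≈1 = trans (Σ-cong k (λ i → trans (pow-cong (toℕ i) z≈1) (pow-1# (toℕ i))))
                              (trans (Σ-const k 1#) (×1#≈cast k))

  module _ {m : ℕ} (F : FiniteField (suc m)) where
    open OverField F
    private module FF = FiniteField F

    *-distribˡ-ΣF× : ∀ c f → c * ΣF× f ≈ ΣF× (λ x → c * f x)
    *-distribˡ-ΣF× c f = trans (*-distribˡ-Σ (suc m) c (λ i → onUnits f (FF.enum i))) (ΣF-cong pointwise)
      where
      pointwise : ∀ x → c * onUnits f x ≈ onUnits (λ y → c * f y) x
      pointwise x with x FF.≟ FF.0#
      ... | yes _ = zeroʳ c
      ... | no  _ = refl

    *-distribʳ-ΣF× : ∀ c f → ΣF× f * c ≈ ΣF× (λ x → f x * c)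
    *-distribʳ-ΣF× c f = trans (*-comm _ _) (trans (*-distribˡ-ΣF× c f) (ΣF×-cong (λ x _ → *-comm c (f x))))

    *-distribʳ-ΣF×² : ∀ c (f : FF.Carrier → FF.Carrier → Carrier) →
      ΣF× (λ x → ΣF× (f x)) * c ≈ ΣF× (λ x → ΣF× (λ y → f x y * c))
    *-distribʳ-ΣF×² c f = trans (*-distribʳ-ΣF× c (λ x → ΣF× (f x))) (ΣF×-cong (λ x _ → *-distribʳ-ΣF× c (f x)))

    ΣF×-* : ∀ f g → ΣF× f * ΣF× g ≈ ΣF× (λ x → ΣF× (λ y → f x * g y))
    ΣF×-* f g = trans (*-distribʳ-ΣF× (ΣF× g) f) (ΣF×-cong (λ x _ → *-distribˡ-ΣF× (f x) g))

    Σ-ΣF×-swap : ∀ k (f : Fin k → FF.Carrier → Carrier) →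
      Σ k (λ i → ΣF× (f i)) ≈ ΣF× (λ x → Σ k (λ i → f i x))
    Σ-ΣF×-swap k f = trans (Σ-swap k (suc m) (λ i j → onUnits (f i) (FF.enum j)))
                           (ΣF-cong (λ x → Σ-ifᵈ (x FF.≟ FF.0#) k (λ i → f i x)))

    ΣF×-swap : ∀ (f : FF.Carrier → FF.Carrier → Carrier) →
      ΣF× (λ x → ΣF× (λ y → f x y)) ≈ ΣF× (λ y → ΣF× (λ x → f x y))
    ΣF×-swap f = begin
      ΣF× (λ x → ΣF× (λ y → f x y))
        ≈⟨ ΣF-cong (λ x → sym (Σ-ifᵈ (x FF.≟ FF.0#) (suc m) (λ j → onUnits (f x) (FF.enum j)))) ⟩
      ΣF (λ x → ΣF (λ y → onUnits (λ x′ → onUnits (f x′) y) x))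
        ≈⟨ Σ-swap (suc m) (suc m) (λ i j → onUnits (λ x′ → onUnits (f x′) (FF.enum j)) (FF.enum i)) ⟩
      ΣF (λ y → ΣF (λ x → onUnits (λ x′ → onUnits (f x′) y) x))
        ≈⟨ ΣF-cong (λ y → ΣF-cong (λ x → commute x y)) ⟩
      ΣF (λ y → ΣF (λ x → onUnits (λ y′ → onUnits (λ x′ → f x′ y′) x) y))
        ≈⟨ ΣF-cong (λ y → Σ-ifᵈ (y FF.≟ FF.0#) (suc m) (λ i → onUnits (λ x′ → f x′ y) (FF.enum i))) ⟩
      ΣF× (λ y → ΣF× (λ x → f x y))
        ∎
      where
      open import Relation.Binary.Reasoning.Setoid setoid
      commute : ∀ x y → onUnits (λ x′ → onUnits (f x′) y) x ≈ onUnits (λ y′ → onUnits (λ x′ → f x′ y′) x) y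
      commute x y with x FF.≟ FF.0# | y FF.≟ FF.0#
      ... | yes _ | yes _ = refl
      ... | yes _ | no  _ = refl
      ... | no  _ | yes _ = refl
      ... | no  _ | no  _ = refl

module FieldProducts (R : CommutativeRing 0ℓ 0ℓ) (isField : IsFieldOn R) where
  open CommutativeRing R
  open FieldProperties R isField
  open FinSum *-commutativeMonoid public

  ×≈pow : ∀ k c → k × c ≈ pow R c k
  ×≈pow zero    c = refl
  ×≈pow (suc k) c = *-congˡ (×≈pow k c)

  Σ-nonzero : ∀ k (f : Fin k → Carrier) → (∀ i → ¬ (f i ≈ 0#)) → ¬ (Σ k f ≈ 0#)
  Σ-nonzero zero    f f≉0 = IsFieldOn.1≉0 isField
  Σ-nonzero (suc k) f f≉0 = *-nonzero (f≉0 fzero) (Σ-nonzero k (λ i → f (fsuc i)) (λ i → f≉0 (fsuc i)))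

¬¬-decidable : ∀ m (P : Fin m → Set) → ¬ ¬ (∀ i → Dec (P i))
¬¬-decidable zero    P k = k (λ ())
¬¬-decidable (suc m) P k = ¬¬-excluded-middle λ d₀ →
  ¬¬-decidable m (λ i → P (fsuc i)) λ ds → k λ { fzero → d₀ ; (fsuc i) → ds i }

prime∤⇒coprime : ∀ {p n} → Prime p → ¬ (p ∣ n) → Coprime p n
prime∤⇒coprime p-prime p∤n (d∣p , d∣n) with prime⇒irreducible p-prime d∣p
... | inj₁ d≡1     = d≡1
... | inj₂ P.refl = ⊥-elim (p∤n d∣n)

module FiniteFieldProperties {m : ℕ} (F : FiniteField (suc m)) where
  open FiniteField F
  open FieldProperties cring isField
  open RingSums cring
  open OverField F

  size≈0 : cast cring (suc m) ≈ 0#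
  size≈0 = x+y≈x⇒y≈0 (sym (begin
    ΣF (λ x → x)              ≈⟨ ΣF-translate 1# (λ x → x) (λ x≈y → x≈y) ⟩
    ΣF (λ x → x + 1#)         ≈⟨ Σ-distrib (suc m) enum (λ _ → 1#) ⟩
    ΣF (λ x → x) + ΣF (λ _ → 1#) ≈⟨ +-congˡ (trans (Σ-const (suc m) 1#) (×1#≈cast (suc m))) ⟩
    ΣF (λ x → x) + cast cring (suc m) ∎))
    where open import Relation.Binary.Reasoning.Setoid setoid

  prime∤size⇒cast≉0 : ∀ {p} → Prime p → ¬ (p ∣ suc m) → ¬ (cast cring p ≈ 0#)
  prime∤size⇒cast≉0 p-prime p∤q = coprime-to-characteristic size≈0 (prime∤⇒coprime p-prime p∤q)

module _ (K : Char0Field) {m : ℕ} (F : FiniteField (suc m)) where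
  private
    module F = FiniteField F
    module K = Char0Field K
    module KP = FieldProperties K.cring K.isField
  open RingSums K.cring
  open OverField F

  ΣF-01-valued-two-ones≉1 : (f : F.Carrier → K.Carrier) → Respects≈ f →
    (∀ x → (f x K.≈ K.0#) ⊎ (f x K.≈ K.1#)) →
    ∀ {u v} → ¬ (v F.≈ u) → f u K.≈ K.1# → f v K.≈ K.1# → ¬ (ΣF f K.≈ K.1#)
  ΣF-01-valued-two-ones≉1 f f-cong f01 {u} {v} v≉u fu≈1 fv≈1 Σf≈1 = K.char0 k (KP.+-cancelˡ K.1# _ _ (begin
    K.1# K.+ (K.1# K.+ cast K.cring k)  ≈⟨ K.+-cong (K.sym fu≈1) (K.+-cong (K.sym f₁v≈1) (K.sym Σf₂≈k)) ⟩
    f u K.+ (f₁ v K.+ ΣF f₂)            ≈⟨ K.sym (K.+-congˡ (ΣF-splitAt v f₁ f₁-cong)) ⟩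
    f u K.+ ΣF f₁                       ≈⟨ K.sym (ΣF-splitAt u f f-cong) ⟩
    ΣF f                                ≈⟨ Σf≈1 ⟩
    K.1#                                ≈⟨ K.sym (K.+-identityʳ K.1#) ⟩
    K.1# K.+ K.0#                       ∎))
    where
    open import Relation.Binary.Reasoning.Setoid K.setoid
    f₁ f₂ : F.Carrier → K.Carrier
    f₁ x = ifᵈ x F.≟ u then K.0# else f x
    f₂ x = ifᵈ x F.≟ v then K.0# else f₁ x
    f₁-cong : Respects≈ f₁
    f₁-cong x≈y = ifᵈ≟-cong x≈y K.refl (f-cong x≈y)
    f₁v≈1 : f₁ v K.≈ K.1#
    f₁v≈1 with v F.≟ u
    ... | yes v≈u = ⊥-elim (v≉u v≈u)
    ... | no  _   = fv≈1
    f₂-01 : ∀ x → (f₂ x K.≈ K.0#) ⊎ (f₂ x K.≈ K.1#)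
    f₂-01 x with x F.≟ v | x F.≟ u
    ... | yes _ | _     = inj₁ K.refl
    ... | no  _ | yes _ = inj₁ K.refl
    ... | no  _ | no  _ = f01 x
    k : ℕ
    k = proj₁ (Σ-01-valued (suc m) (λ i → f₂ (F.enum i)) (λ i → f₂-01 (F.enum i)))
    Σf₂≈k : ΣF f₂ K.≈ cast K.cring k
    Σf₂≈k = proj₂ (Σ-01-valued (suc m) (λ i → f₂ (F.enum i)) (λ i → f₂-01 (F.enum i)))

module AdditiveCharacter {m : ℕ} (F : FiniteField (suc m)) (K : Char0Field) (Ψ : AddChar F K) where
  private
    module F = FiniteField F
    module K = Char0Field K
    module KP = FieldProperties K.cring K.isField
  open AddChar Ψ
  open RingSums K.cring
  open OverField F
  open import Relation.Binary.Reasoning.Setoid K.setoid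

  ψ-0≈1 : ψ F.0# K.≈ K.1#
  ψ-0≈1 = KP.idempotent⇒1# (ψ-unit F.0#) (K.trans (K.sym (ψ-hom F.0# F.0#)) (ψ-cong (F.+-identityʳ _)))

  Σψ≈0 : ΣF ψ K.≈ K.0#
  Σψ≈0 with ψ-nontriv
  ... | x₀ , ψx₀≉1 = KP.fixedBy≉1⇒0# ψx₀≉1 (K.sym (begin
    ΣF ψ                    ≈⟨ ΣF-translate x₀ ψ ψ-cong ⟩
    ΣF (λ x → ψ (x F.+ x₀)) ≈⟨ ΣF-cong (λ x → K.trans (ψ-hom x x₀) (K.*-comm _ _)) ⟩
    ΣF (λ x → ψ x₀ K.* ψ x) ≈⟨ K.sym (*-distribˡ-Σ (suc m) (ψ x₀) (λ i → ψ (F.enum i))) ⟩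
    ψ x₀ K.* ΣF ψ           ∎))

  Σψ-split : ∀ a → ΣF (λ z → ψ (a F.* z)) K.≈ K.1# K.+ ΣF× (λ z → ψ (a F.* z))
  Σψ-split a = K.trans (ΣF-splitAt F.0# (λ z → ψ (a F.* z)) (λ z≈w → ψ-cong (F.*-congˡ z≈w)))
                       (K.+-congʳ (K.trans (ψ-cong (F.zeroʳ a)) ψ-0≈1))

  Σ×ψ : ∀ a → ΣF× (λ z → ψ (a F.* z)) K.≈ (ifᵈ a F.≟ F.0# then cast K.cring m else K.- K.1#)
  Σ×ψ a with a F.≟ F.0#
  ... | yes a≈0 = KP.+-cancelˡ K.1# _ _ (begin
    K.1# K.+ ΣF× (λ z → ψ (a F.* z)) ≈⟨ K.sym (Σψ-split a) ⟩
    ΣF (λ z → ψ (a F.* z))           ≈⟨ ΣF-cong (λ z → K.trans (ψ-cong (F.trans (F.*-congʳ a≈0) (F.zeroˡ z))) ψ-0≈1) ⟩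
    ΣF (λ _ → K.1#)                  ≈⟨ K.trans (Σ-const (suc m) K.1#) (×1#≈cast (suc m)) ⟩
    K.1# K.+ cast K.cring m          ∎)
  ... | no  a≉0 = KP.x+y≈0⇒y≈-x (begin
    K.1# K.+ ΣF× (λ z → ψ (a F.* z)) ≈⟨ K.sym (Σψ-split a) ⟩
    ΣF (λ z → ψ (a F.* z))           ≈⟨ K.sym (ΣF-dilate a≉0 ψ ψ-cong) ⟩
    ΣF ψ                             ≈⟨ Σψ≈0 ⟩
    K.0#                             ∎)

module MultiplicativeCharacter {n : ℕ} (F : FiniteField (suc (suc n))) (K : Char0Field) (Ω : GenMulChar F K) where
  private
    module F = FiniteField F
    module K = Char0Field K
    module FP = FieldProperties F.cring F.isField
    module KP = FieldProperties K.cring K.isField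
    module Π = FieldProducts K.cring K.isField
  open GenMulChar Ω
  open RingSums K.cring
  open OverField F
  open import Relation.Binary.Reasoning.Setoid K.setoid

  infixr 8 _^_
  _^_ : K.Carrier → ℕ → K.Carrier
  x ^ k = pow K.cring x k

  q-1 : K.Carrier
  q-1 = cast K.cring (suc n)

  q-1≉0 : ¬ (q-1 K.≈ K.0#)
  q-1≉0 = K.char0 n

  ω-1≈1 : ω F.1# K.≈ K.1#
  ω-1≈1 = KP.idempotent⇒1# (ω-unit F.1# F.1≉0) (K.trans (K.sym (ω-hom F.1# F.1# F.1≉0 F.1≉0)) (ω-cong (F.*-identityˡ _)))

  ω-inv : ∀ x → ¬ (x F.≈ F.0#) → ω (F.inv x) K.≈ K.inv (ω x)
  ω-inv x x≉0 = KP.inv-unique (ω-unit x x≉0)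
    (K.trans (K.sym (ω-hom x (F.inv x) x≉0 (FP.inv-nonzero x≉0))) (K.trans (ω-cong (F.inv-r x x≉0)) ω-1≈1))

  ω-pow : ∀ x → ¬ (x F.≈ F.0#) → ∀ k → ω (pow F.cring x k) K.≈ ω x ^ k
  ω-pow x x≉0 zero    = ω-1≈1
  ω-pow x x≉0 (suc k) = K.trans (ω-hom x _ x≉0 (FP.pow-nonzero k x≉0)) (K.*-congˡ (ω-pow x x≉0 k))

  ω^[q-1]≈1 : ∀ a → ¬ (a F.≈ F.0#) → ω a ^ suc n K.≈ K.1#
  ω^[q-1]≈1 a a≉0 = KP.*-cancelˡ Πg≉0 (begin
    Πg K.* ω a ^ suc n         ≈⟨ K.*-comm _ _ ⟩
    ω a ^ suc n K.* Πg         ≈⟨ K.*-congʳ (K.sym (K.trans (ΠF.ΣF-hitOnce F.0# K.1# (ω a)) (K.trans (K.*-identityˡ _) (Π.×≈pow (suc n) (ω a))))) ⟩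
    ΠF.ΣF (λ x → ifᵈ x F.≟ F.0# then K.1# else ω a) K.* Πg
                               ≈⟨ K.sym (Π.Σ-distrib (suc (suc n)) (λ i → ifᵈ F.enum i F.≟ F.0# then K.1# else ω a) (λ i → g (F.enum i))) ⟩
    ΠF.ΣF (λ x → (ifᵈ x F.≟ F.0# then K.1# else ω a) K.* g x)
                               ≈⟨ K.sym (ΠF.ΣF-cong dilated) ⟩
    ΠF.ΣF (λ x → g (a F.* x))  ≈⟨ K.sym (ΠF.ΣF-dilate a≉0 g g-cong) ⟩
    Πg                         ≈⟨ K.sym (K.*-identityʳ Πg) ⟩
    Πg K.* K.1#                ∎)
    where
    module ΠF = Π.OverField F
    g : F.Carrier → K.Carrier
    g x = ifᵈ x F.≟ F.0# then K.1# else ω x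
    g-cong : ΠF.Respects≈ g
    g-cong x≈y = ΠF.ifᵈ≟-cong x≈y K.refl (ω-cong x≈y)
    Πg : K.Carrier
    Πg = ΠF.ΣF g
    Πg≉0 : ¬ (Πg K.≈ K.0#)
    Πg≉0 = Π.Σ-nonzero (suc (suc n)) (λ i → g (F.enum i)) (λ i → g≉0 (F.enum i))
      where
      g≉0 : ∀ x → ¬ (g x K.≈ K.0#)
      g≉0 x with x F.≟ F.0#
      ... | yes _   = K.1≉0
      ... | no  x≉0 = ω-unit x x≉0
    dilated : ∀ x → g (a F.* x) K.≈ (ifᵈ x F.≟ F.0# then K.1# else ω a) K.* g x
    dilated x with x F.≟ F.0# | (a F.* x) F.≟ F.0#
    ... | yes _   | yes _     = K.sym (K.*-identityˡ _)
    ... | yes x≈0 | no  ax≉0 = ⊥-elim (ax≉0 (F.trans (F.*-congˡ x≈0) (F.zeroʳ a)))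
    ... | no  x≉0 | yes ax≈0 = ⊥-elim (FP.*-nonzero a≉0 x≉0 ax≈0)
    ... | no  x≉0 | no  _     = ω-hom a x a≉0 x≉0

  ω^-cong : ∀ k → Respects≈ (λ x → ω x ^ k)
  ω^-cong k x≈y = KP.pow-cong k (ω-cong x≈y)

  Σ×1≈q-1 : ΣF× (λ _ → K.1#) K.≈ q-1
  Σ×1≈q-1 = K.trans (ΣF-hitOnce F.0# K.0# K.1#) (K.trans (K.+-identityˡ _) (×1#≈cast (suc n)))

  Σ×ω^k≈0 : ∀ k → 0 < k → k < suc n → ΣF× (λ x → ω x ^ k) K.≈ K.0#
  Σ×ω^k≈0 k 0<k k<q-1 with ω-gen k 0<k k<q-1
  ... | y , y≉0 , ωyᵏ≉1 = KP.fixedBy≉1⇒0# ωyᵏ≉1 (K.sym (begin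
    ΣF× (λ x → ω x ^ k)               ≈⟨ ΣF×-dilate y≉0 (λ x → ω x ^ k) (ω^-cong k) ⟩
    ΣF× (λ x → ω (y F.* x) ^ k)       ≈⟨ ΣF×-cong (λ x x≉0 → K.trans (KP.pow-cong k (ω-hom y x y≉0 x≉0)) (KP.pow-distrib-* _ _ k)) ⟩
    ΣF× (λ x → ω y ^ k K.* ω x ^ k)   ≈⟨ K.sym (*-distribˡ-ΣF× F (ω y ^ k) (λ x → ω x ^ k)) ⟩
    ω y ^ k K.* ΣF× (λ x → ω x ^ k)   ∎))

  Σ-Σ×ω^≈q-1 : Σ (suc n) (λ i → ΣF× (λ x → ω x ^ toℕ i)) K.≈ q-1
  Σ-Σ×ω^≈q-1 = K.trans (K.+-cong Σ×1≈q-1 (K.trans (Σ-cong n higher) (Σ-ε n))) (K.+-identityʳ _)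
    where
    higher : ∀ j → ΣF× (λ x → ω x ^ suc (toℕ j)) K.≈ K.0#
    higher j = Σ×ω^k≈0 (suc (toℕ j)) (s≤s z≤n) (s≤s (toℕ<n j))

  geometric-ω-trivial : ∀ x → ω x K.≈ K.1# → geometric (ω x) (suc n) K.≈ q-1
  geometric-ω-trivial x ωx≈1 = geometric-1 (ω x) (suc n) ωx≈1

  geometric-ω-nontrivial : ∀ x → ¬ (x F.≈ F.0#) → ¬ (ω x K.≈ K.1#) → geometric (ω x) (suc n) K.≈ K.0#
  geometric-ω-nontrivial x x≉0 ωx≉1 = KP.fixedBy≉1⇒0# ωx≉1 (geometric-fixed (ω x) (suc n) (ω^[q-1]≈1 x x≉0))

  module _ (ω≟1 : ∀ x → Dec (ω x K.≈ K.1#)) where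
    inKernel : F.Carrier → K.Carrier
    inKernel x = ifᵈ ω≟1 x then K.1# else K.0#

    inKernel-cong : Respects≈ inKernel
    inKernel-cong {x} {y} x≈y = ifᵈ-cong K.setoid (ω≟1 x) (ω≟1 y)
      (K.trans (ω-cong (F.sym x≈y))) (K.trans (ω-cong x≈y)) K.refl K.refl

    kernel-size≈1 : ΣF× inKernel K.≈ K.1#
    kernel-size≈1 = KP.*-cancelˡ q-1≉0 (begin
      q-1 K.* ΣF× inKernel                                ≈⟨ *-distribˡ-ΣF× F q-1 inKernel ⟩
      ΣF× (λ x → q-1 K.* inKernel x)                      ≈⟨ K.sym (ΣF×-cong geometric≈) ⟩
      ΣF× (λ x → geometric (ω x) (suc n))                 ≈⟨ K.sym (Σ-ΣF×-swap F (suc n) (λ i x → ω x ^ toℕ i)) ⟩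
      Σ (suc n) (λ i → ΣF× (λ x → ω x ^ toℕ i))           ≈⟨ Σ-Σ×ω^≈q-1 ⟩
      q-1                                                 ≈⟨ K.sym (K.*-identityʳ q-1) ⟩
      q-1 K.* K.1#                                        ∎)
      where
      geometric≈ : ∀ x → ¬ (x F.≈ F.0#) → geometric (ω x) (suc n) K.≈ q-1 K.* inKernel x
      geometric≈ x x≉0 with ω≟1 x
      ... | yes ωx≈1 = K.trans (geometric-ω-trivial x ωx≈1) (K.sym (K.*-identityʳ q-1))
      ... | no  ωx≉1 = K.trans (geometric-ω-nontrivial x x≉0 ωx≉1) (K.sym (K.zeroʳ q-1))

  -- Counting with the geometric sums shows the kernel of ω has exactly one element, yet it would
  -- contain 1 and a. Equality in K is undecidable, but refuting this only needs decisions under ¬¬.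
  ω-kernel-trivial : ∀ a → ¬ (a F.≈ F.0#) → ω a K.≈ K.1# → a F.≈ F.1#
  ω-kernel-trivial a a≉0 ωa≈1 with a F.≟ F.1#
  ... | yes a≈1 = a≈1
  ... | no  a≉1 = ⊥-elim (¬¬-decidable (suc (suc n)) (λ i → ω (F.enum i) K.≈ K.1#) contradiction)
    where
    contradiction : (∀ i → Dec (ω (F.enum i) K.≈ K.1#)) → ⊥
    contradiction ω≟1-enum =
      ΣF-01-valued-two-ones≉1 K F restricted (onUnits-cong (inKernel-cong ω≟1)) restricted-01 a≉1
        (restricted≈1 F.1≉0 ω-1≈1) (restricted≈1 a≉0 ωa≈1) (kernel-size≈1 ω≟1)
      where
      ω≟1 : ∀ x → Dec (ω x K.≈ K.1#)
      ω≟1 x with ω≟1-enum (indexOf x)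
      ... | yes ωx≈1 = yes (K.trans (ω-cong (F.sym (enum-indexOf x))) ωx≈1)
      ... | no  ωx≉1 = no (λ ωx≈1 → ωx≉1 (K.trans (ω-cong (enum-indexOf x)) ωx≈1))
      restricted : F.Carrier → K.Carrier
      restricted = onUnits (inKernel ω≟1)
      restricted-01 : ∀ x → (restricted x K.≈ K.0#) ⊎ (restricted x K.≈ K.1#)
      restricted-01 x with x F.≟ F.0# | ω≟1 x
      ... | yes _ | _     = inj₁ K.refl
      ... | no  _ | yes _ = inj₂ K.refl
      ... | no  _ | no  _ = inj₁ K.refl
      restricted≈1 : ∀ {x} → ¬ (x F.≈ F.0#) → ω x K.≈ K.1# → restricted x K.≈ K.1#
      restricted≈1 {x} x≉0 ωx≈1 with x F.≟ F.0# | ω≟1 x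
      ... | yes x≈0 | _        = ⊥-elim (x≉0 x≈0)
      ... | no  _   | yes _    = K.refl
      ... | no  _   | no  ωx≉1 = ⊥-elim (ωx≉1 ωx≈1)

  orthogonality : ∀ r → ¬ (r F.≈ F.0#) → geometric (ω r) (suc n) K.≈ (ifᵈ r F.≟ F.1# then q-1 else K.0#)
  orthogonality r r≉0 with r F.≟ F.1#
  ... | yes r≈1 = geometric-ω-trivial r (K.trans (ω-cong r≈1) ω-1≈1)
  ... | no  r≉1 = geometric-ω-nontrivial r r≉0 (λ ωr≈1 → r≉1 (ω-kernel-trivial r r≉0 ωr≈1))

module _ {q : ℕ} (F : FiniteField q) (K : Char0Field) (Ψ : AddChar F K) (Ω : GenMulChar F K) where
  private
    module F = FiniteField F
    module K = Char0Field K
  open AddChar Ψ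
  open GenMulChar Ω
  open RingSums K.cring

  -- The summand of gauss is local to its definition; gaussTerm recovers it by unification.
  private
    gaussTerm : ℤ → Fin q → K.Carrier
    gaussTerm k = proj₁ unfolded
      where
      unfolded : ∃ λ (term : Fin q → K.Carrier) → gauss F K Ψ Ω k ≡ sumFin K._+_ K.0# q term
      unfolded = _ , P.refl

  gauss-unfold : ∀ k → gauss F K Ψ Ω k K.≈
    Σ q (λ i → ifᵈ F.enum i F.≟ F.0# then K.0# else powℤ F K (ω (F.enum i)) k K.* ψ (F.enum i))
  gauss-unfold k = Σ-cong q pointwise
    where
    pointwise : ∀ i → gaussTerm k i K.≈ (ifᵈ F.enum i F.≟ F.0# then K.0# else powℤ F K (ω (F.enum i)) k K.* ψ (F.enum i))
    pointwise i with F.enum i F.≟ F.0#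
    ... | yes _ = K.refl
    ... | no  _ = K.refl

module GaussSums {n : ℕ} (F : FiniteField (suc (suc n))) (K : Char0Field) (Ψ : AddChar F K) (Ω : GenMulChar F K) where
  private
    module F = FiniteField F
    module K = Char0Field K
    module FP = FieldProperties F.cring F.isField
    module KP = FieldProperties K.cring K.isField
  open AddChar Ψ
  open GenMulChar Ω
  open AdditiveCharacter F K Ψ
  open MultiplicativeCharacter F K Ω
  open RingSums K.cring
  open OverField F
  open import Relation.Binary.Reasoning.Setoid K.setoid

  g : ℤ → K.Carrier
  g = gauss F K Ψ Ω

  g≈ΣF× : ∀ k → g k K.≈ ΣF× (λ x → powℤ F K (ω x) k K.* ψ x)
  g≈ΣF× = gauss-unfold F K Ψ Ω

  g-pos : ∀ k → g (+ k) K.≈ ΣF× (λ x → ω x ^ k K.* ψ x)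
  g-pos k = g≈ΣF× (+ k)

  g-neg : ∀ k → g (-ℤ (+ k)) K.≈ ΣF× (λ x → ω (F.inv x) ^ k K.* ψ x)
  g-neg k = K.trans (g≈ΣF× (-ℤ (+ k))) (ΣF×-cong (λ x x≉0 → K.*-congʳ {ψ x} (K.trans (powℤ-neg (ω x) k)
                                                 (KP.pow-cong k (K.sym (ω-inv x x≉0))))))
    where
    powℤ-neg : ∀ z k → powℤ F K z (-ℤ (+ k)) K.≈ K.inv z ^ k
    powℤ-neg z zero    = K.refl
    powℤ-neg z (suc k) = K.refl

  g-0 : g (+ 0) K.≈ K.- K.1#
  g-0 = begin
    g (+ 0)                              ≈⟨ g-pos 0 ⟩
    ΣF× (λ x → K.1# K.* ψ x)             ≈⟨ ΣF×-cong (λ x _ → K.trans (K.*-identityˡ _) (ψ-cong (F.sym (F.*-identityˡ x)))) ⟩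
    ΣF× (λ x → ψ (F.1# F.* x))           ≈⟨ Σ×ψ F.1# ⟩
    (ifᵈ F.1# F.≟ F.0# then q-1 else K.- K.1#) ≈⟨ ifᵈ-else (F.1# F.≟ F.0#) F.1≉0 ⟩
    K.- K.1#                             ∎
    where
    ifᵈ-else : ∀ {P : Set} (d : Dec P) → ¬ P → ∀ {a b} → (ifᵈ d then a else b) K.≈ b
    ifᵈ-else (yes p) ¬p = ⊥-elim (¬p p)
    ifᵈ-else (no _)  _  = K.refl

  ΣF×³ : (F.Carrier → F.Carrier → F.Carrier → K.Carrier) → K.Carrier
  ΣF×³ f = ΣF× λ z → ΣF× λ x → ΣF× λ y → f x y z

  ΣF×³-cong : ∀ {f g} → (∀ x y z → ¬ (x F.≈ F.0#) → ¬ (y F.≈ F.0#) → ¬ (z F.≈ F.0#) → f x y z K.≈ g x y z) →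
    ΣF×³ f K.≈ ΣF×³ g
  ΣF×³-cong f≈g = ΣF×-cong λ z z≉0 → ΣF×-cong λ x x≉0 → ΣF×-cong λ y y≉0 → f≈g x y z x≉0 y≉0 z≉0

  Σ-ΣF×³-swap : ∀ k (f : Fin k → F.Carrier → F.Carrier → F.Carrier → K.Carrier) →
    Σ k (λ i → ΣF×³ (f i)) K.≈ ΣF×³ (λ x y z → Σ k (λ i → f i x y z))
  Σ-ΣF×³-swap k f =
    K.trans (Σ-ΣF×-swap F k (λ i z → ΣF× λ x → ΣF× λ y → f i x y z)) (ΣF×-cong λ z _ →
    K.trans (Σ-ΣF×-swap F k (λ i x → ΣF× λ y → f i x y z))           (ΣF×-cong λ x _ →
            (Σ-ΣF×-swap F k (λ i y → f i x y z))))

  *-distribˡ-ΣF×³ : ∀ c f → c K.* ΣF×³ f K.≈ ΣF×³ (λ x y z → c K.* f x y z)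
  *-distribˡ-ΣF×³ c f =
    K.trans (*-distribˡ-ΣF× F c (λ z → ΣF× λ x → ΣF× λ y → f x y z)) (ΣF×-cong λ z _ →
    K.trans (*-distribˡ-ΣF× F c (λ x → ΣF× λ y → f x y z))           (ΣF×-cong λ x _ →
            (*-distribˡ-ΣF× F c (λ y → f x y z))))

  module _ (c : F.Carrier) (c≉0 : ¬ (c F.≈ F.0#)) where
    private
      _^ᶠ_ : F.Carrier → ℕ → F.Carrier
      x ^ᶠ k = pow F.cring x k

    Y : F.Carrier → F.Carrier → F.Carrier
    Y x z = (c F.* x ^ᶠ 3) F.* F.inv z ^ᶠ 2

    ratio : F.Carrier → F.Carrier → F.Carrier → F.Carrier
    ratio x y z = Y x z F.* F.inv y

    Y≉0 : ∀ {x z} → ¬ (x F.≈ F.0#) → ¬ (z F.≈ F.0#) → ¬ (Y x z F.≈ F.0#)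
    Y≉0 x≉0 z≉0 = FP.*-nonzero (FP.*-nonzero c≉0 (FP.pow-nonzero 3 x≉0)) (FP.pow-nonzero 2 (FP.inv-nonzero z≉0))

    ratio≉0 : ∀ {x y z} → ¬ (x F.≈ F.0#) → ¬ (y F.≈ F.0#) → ¬ (z F.≈ F.0#) → ¬ (ratio x y z F.≈ F.0#)
    ratio≉0 x≉0 y≉0 z≉0 = FP.*-nonzero (Y≉0 x≉0 z≉0) (FP.inv-nonzero y≉0)

    ω-ratio : ∀ {x y z} → ¬ (x F.≈ F.0#) → ¬ (y F.≈ F.0#) → ¬ (z F.≈ F.0#) →
      ω (ratio x y z) K.≈ ((ω c K.* ω x ^ 3) K.* ω (F.inv z) ^ 2) K.* ω (F.inv y)
    ω-ratio {x} {y} {z} x≉0 y≉0 z≉0 = begin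
      ω (ratio x y z)                                          ≈⟨ ω-hom _ _ (Y≉0 x≉0 z≉0) (FP.inv-nonzero y≉0) ⟩
      ω (Y x z) K.* ω (F.inv y)                                ≈⟨ K.*-congʳ (ω-hom _ _ cx³≉0 (FP.pow-nonzero 2 (FP.inv-nonzero z≉0))) ⟩
      (ω (c F.* x ^ᶠ 3) K.* ω (F.inv z ^ᶠ 2)) K.* ω (F.inv y)  ≈⟨ K.*-congʳ (K.*-cong (ω-hom _ _ c≉0 (FP.pow-nonzero 3 x≉0))
                                                                                  (ω-pow _ (FP.inv-nonzero z≉0) 2)) ⟩
      ((ω c K.* ω (x ^ᶠ 3)) K.* ω (F.inv z) ^ 2) K.* ω (F.inv y) ≈⟨ K.*-congʳ (K.*-congʳ (K.*-congˡ (ω-pow x x≉0 3))) ⟩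
      ((ω c K.* ω x ^ 3) K.* ω (F.inv z) ^ 2) K.* ω (F.inv y)  ∎
      where
      cx³≉0 : ¬ (c F.* x ^ᶠ 3 F.≈ F.0#)
      cx³≉0 = FP.*-nonzero c≉0 (FP.pow-nonzero 3 x≉0)

    ω-ratio^ : ∀ {x y z} → ¬ (x F.≈ F.0#) → ¬ (y F.≈ F.0#) → ¬ (z F.≈ F.0#) → ∀ m →
      ω (ratio x y z) ^ m K.≈ ((ω c ^ m K.* ω x ^ (3 *ℕ m)) K.* ω (F.inv z) ^ (2 *ℕ m)) K.* ω (F.inv y) ^ m
    ω-ratio^ x≉0 y≉0 z≉0 m = K.trans (KP.pow-cong m (ω-ratio x≉0 y≉0 z≉0))
      (K.trans (KP.pow-distrib-* _ _ m) (K.*-congʳ (K.trans (KP.pow-distrib-* _ _ m)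
        (K.*-cong (K.trans (KP.pow-distrib-* _ _ m) (K.*-congˡ (KP.pow-pow _ 3 m))) (KP.pow-pow _ 2 m)))))

    A : ℕ → K.Carrier
    A m = ((g (+ (3 *ℕ m)) K.* g (-ℤ (+ m))) K.* g (-ℤ (+ (2 *ℕ m)))) K.* ω c ^ m

    A-expand : ∀ m → A m K.≈ ΣF×³ (λ x y z → ω (ratio x y z) ^ m K.* ψ ((x F.+ y) F.+ z))
    A-expand m = begin
      A m                                                                ≈⟨ K.*-congʳ (K.*-cong (K.*-cong (g-pos _) (g-neg m)) (g-neg _)) ⟩
      ((ΣF× a K.* ΣF× b) K.* ΣF× d) K.* w                                ≈⟨ K.*-congʳ (*-distribˡ-ΣF× F _ d) ⟩
      ΣF× (λ z → (ΣF× a K.* ΣF× b) K.* d z) K.* w                        ≈⟨ *-distribʳ-ΣF× F w (λ z → (ΣF× a K.* ΣF× b) K.* d z) ⟩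
      ΣF× (λ z → ((ΣF× a K.* ΣF× b) K.* d z) K.* w)                      ≈⟨ ΣF×-cong (λ z _ → expand z) ⟩
      ΣF× (λ z → ΣF× (λ x → ΣF× (λ y → ((a x K.* b y) K.* d z) K.* w)))  ≈⟨ ΣF×³-cong combine ⟩
      ΣF×³ (λ x y z → ω (ratio x y z) ^ m K.* ψ ((x F.+ y) F.+ z))       ∎
      where
      w : K.Carrier
      w = ω c ^ m
      a b d : F.Carrier → K.Carrier
      a x = ω x ^ (3 *ℕ m) K.* ψ x
      b y = ω (F.inv y) ^ m K.* ψ y
      d z = ω (F.inv z) ^ (2 *ℕ m) K.* ψ z
      expand : ∀ z → ((ΣF× a K.* ΣF× b) K.* d z) K.* w K.≈ ΣF× (λ x → ΣF× (λ y → ((a x K.* b y) K.* d z) K.* w))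
      expand z = K.trans (K.*-congʳ (K.trans (K.*-congʳ (ΣF×-* F a b)) (*-distribʳ-ΣF×² F (d z) (λ x y → a x K.* b y))))
                         (*-distribʳ-ΣF×² F w (λ x y → (a x K.* b y) K.* d z))
      combine : ∀ x y z → ¬ (x F.≈ F.0#) → ¬ (y F.≈ F.0#) → ¬ (z F.≈ F.0#) →
        ((a x K.* b y) K.* d z) K.* w K.≈ ω (ratio x y z) ^ m K.* ψ ((x F.+ y) F.+ z)
      combine x y z x≉0 y≉0 z≉0 = K.trans
        (KP.solve 7 (λ p₁ s₁ p₂ s₂ p₃ s₃ p₄ → (((p₁ KP.:* s₁) KP.:* (p₂ KP.:* s₂)) KP.:* (p₃ KP.:* s₃)) KP.:* p₄ KP.:=
                       (((p₄ KP.:* p₁) KP.:* p₃) KP.:* p₂) KP.:* ((s₁ KP.:* s₂) KP.:* s₃))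
                    K.refl (ω x ^ (3 *ℕ m)) (ψ x) (ω (F.inv y) ^ m) (ψ y) (ω (F.inv z) ^ (2 *ℕ m)) (ψ z) w)
        (K.*-cong (K.sym (ω-ratio^ x≉0 y≉0 z≉0 m)) (K.sym (K.trans (ψ-hom _ _) (K.*-congʳ (ψ-hom _ _)))))

    ratio≈1⇒y≈Y : ∀ {x y z} → ¬ (y F.≈ F.0#) → ratio x y z F.≈ F.1# → y F.≈ Y x z
    ratio≈1⇒y≈Y {x} {y} {z} y≉0 r≈1 = F.sym (F.trans (F.sym (F.*-identityʳ _)) (F.trans (F.*-congˡ (F.sym (FP.inverseˡ y y≉0)))
      (F.trans (F.sym (F.*-assoc _ _ _)) (F.trans (F.*-congʳ r≈1) (F.*-identityˡ y)))))

    y≈Y⇒ratio≈1 : ∀ {x y z} → ¬ (y F.≈ F.0#) → y F.≈ Y x z → ratio x y z F.≈ F.1#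
    y≈Y⇒ratio≈1 {x} {y} {z} y≉0 y≈Y = F.trans (F.*-congʳ (F.sym y≈Y)) (F.inv-r y y≉0)

    Σ×-on-ratio≈1 : ∀ {x z} → ¬ (x F.≈ F.0#) → ¬ (z F.≈ F.0#) →
      ΣF× (λ y → ifᵈ ratio x y z F.≟ F.1# then ψ ((x F.+ y) F.+ z) else K.0#) K.≈ ψ ((x F.+ Y x z) F.+ z)
    Σ×-on-ratio≈1 {x} {z} x≉0 z≉0 = K.trans (ΣF-cong pointwise) (ΣF-indicator (Y x z) _)
      where
      pointwise : ∀ y → (ifᵈ y F.≟ F.0# then K.0# else (ifᵈ ratio x y z F.≟ F.1# then ψ ((x F.+ y) F.+ z) else K.0#))
                        K.≈ (ifᵈ y F.≟ Y x z then ψ ((x F.+ Y x z) F.+ z) else K.0#)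
      pointwise y with y F.≟ F.0# | y F.≟ Y x z
      ... | yes y≈0 | yes y≈Y = ⊥-elim (Y≉0 x≉0 z≉0 (F.trans (F.sym y≈Y) y≈0))
      ... | yes _   | no  _   = K.refl
      ... | no  y≉0 | y≟Y     with ratio x y z F.≟ F.1#
      ...   | yes r≈1 = ψ-on-Y y≟Y
        where
        ψ-on-Y : (d : Dec (y F.≈ Y x z)) → ψ ((x F.+ y) F.+ z) K.≈ (ifᵈ d then ψ ((x F.+ Y x z) F.+ z) else K.0#)
        ψ-on-Y (yes y≈Y) = ψ-cong (F.+-congʳ (F.+-congˡ y≈Y))
        ψ-on-Y (no  y≉Y) = ⊥-elim (y≉Y (ratio≈1⇒y≈Y y≉0 r≈1))
      ...   | no  r≉1 = zero-off-Y y≟Y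
        where
        zero-off-Y : (d : Dec (y F.≈ Y x z)) → K.0# K.≈ (ifᵈ d then ψ ((x F.+ Y x z) F.+ z) else K.0#)
        zero-off-Y (yes y≈Y) = ⊥-elim (r≉1 (y≈Y⇒ratio≈1 y≉0 y≈Y))
        zero-off-Y (no  _)   = K.refl

    ΣA≈ : Σ (suc n) (λ i → A (toℕ i)) K.≈ q-1 K.* ΣF× (λ z → ΣF× (λ x → ψ ((x F.+ Y x z) F.+ z)))
    ΣA≈ = begin
      Σ (suc n) (λ i → A (toℕ i))                                 ≈⟨ Σ-cong (suc n) (λ i → A-expand (toℕ i)) ⟩
      Σ (suc n) (λ i → ΣF×³ (λ x y z → term (toℕ i) x y z))      ≈⟨ Σ-ΣF×³-swap (suc n) (λ i → term (toℕ i)) ⟩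
      ΣF×³ (λ x y z → Σ (suc n) (λ i → term (toℕ i) x y z))      ≈⟨ ΣF×³-cong orthogonal ⟩
      ΣF×³ (λ x y z → q-1 K.* onRatio≈1 x y z)                   ≈⟨ K.sym (*-distribˡ-ΣF×³ q-1 onRatio≈1) ⟩
      q-1 K.* ΣF×³ onRatio≈1                                      ≈⟨ K.*-congˡ (ΣF×-cong λ z z≉0 → ΣF×-cong λ x x≉0 → Σ×-on-ratio≈1 x≉0 z≉0) ⟩
      q-1 K.* ΣF× (λ z → ΣF× (λ x → ψ ((x F.+ Y x z) F.+ z)))    ∎
      where
      term : ℕ → F.Carrier → F.Carrier → F.Carrier → K.Carrier
      term m x y z = ω (ratio x y z) ^ m K.* ψ ((x F.+ y) F.+ z)
      onRatio≈1 : F.Carrier → F.Carrier → F.Carrier → K.Carrier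
      onRatio≈1 x y z = ifᵈ ratio x y z F.≟ F.1# then ψ ((x F.+ y) F.+ z) else K.0#
      orthogonal : ∀ x y z → ¬ (x F.≈ F.0#) → ¬ (y F.≈ F.0#) → ¬ (z F.≈ F.0#) →
        Σ (suc n) (λ i → term (toℕ i) x y z) K.≈ q-1 K.* onRatio≈1 x y z
      orthogonal x y z x≉0 y≉0 z≉0 = K.trans (K.sym (*-distribʳ-Σ (suc n) _ (λ i → ω (ratio x y z) ^ toℕ i)))
        (K.trans (K.*-congʳ (orthogonality (ratio x y z) (ratio≉0 x≉0 y≉0 z≉0))) (scale (ratio x y z F.≟ F.1#)))
        where
        scale : ∀ {P : Set} (d : Dec P) → (ifᵈ d then q-1 else K.0#) K.* ψ ((x F.+ y) F.+ z)
                                          K.≈ q-1 K.* (ifᵈ d then ψ ((x F.+ y) F.+ z) else K.0#)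
        scale (yes _) = K.refl
        scale (no _)  = K.trans (K.zeroˡ _) (K.sym (K.zeroʳ q-1))

    h : F.Carrier → F.Carrier
    h u = (F.1# F.+ u) F.+ c F.* u ^ᶠ 3

    dilated-exponent : ∀ {z} u → ¬ (z F.≈ F.0#) → ((z F.* u) F.+ Y (z F.* u) z) F.+ z F.≈ h u F.* z
    dilated-exponent {z} u z≉0 = F.trans (F.+-congʳ (F.+-congˡ Y-dilated)) distribute
      where
      z⁻¹ : F.Carrier
      z⁻¹ = F.inv z
      Y-dilated : Y (z F.* u) z F.≈ (c F.* u ^ᶠ 3) F.* z
      Y-dilated = F.trans
        (FP.solve 4 (λ c′ z′ u′ i′ →
            (c′ FP.:* ((z′ FP.:* u′) FP.:* ((z′ FP.:* u′) FP.:* ((z′ FP.:* u′) FP.:* FP.con 1)))) FP.:* (i′ FP.:* (i′ FP.:* FP.con 1))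
            FP.:= ((c′ FP.:* (u′ FP.:* (u′ FP.:* (u′ FP.:* FP.con 1)))) FP.:* z′) FP.:* ((z′ FP.:* i′) FP.:* (z′ FP.:* i′)))
          F.refl c z u z⁻¹)
        (F.trans (F.*-congˡ (F.trans (F.*-cong (F.inv-r z z≉0) (F.inv-r z z≉0)) (F.*-identityʳ F.1#))) (F.*-identityʳ _))
      distribute : ((z F.* u) F.+ (c F.* u ^ᶠ 3) F.* z) F.+ z F.≈ h u F.* z
      distribute = FP.solve 3 (λ z′ u′ p′ → ((z′ FP.:* u′) FP.:+ p′ FP.:* z′) FP.:+ z′ FP.:= ((FP.con 1 FP.:+ u′) FP.:+ p′) FP.:* z′)
        F.refl z u (c F.* u ^ᶠ 3)

    Σ×Σ×ψ-constrained : ΣF× (λ z → ΣF× (λ x → ψ ((x F.+ Y x z) F.+ z)))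
                         K.≈ ΣF× (λ u → ifᵈ h u F.≟ F.0# then q-1 else K.- K.1#)
    Σ×Σ×ψ-constrained = begin
      ΣF× (λ z → ΣF× (λ x → ψ ((x F.+ Y x z) F.+ z)))  ≈⟨ ΣF×-cong (λ z z≉0 → K.trans (ΣF×-dilate z≉0 _ (exponent-cong z))
                                                            (ΣF×-cong (λ u _ → ψ-cong (dilated-exponent u z≉0)))) ⟩
      ΣF× (λ z → ΣF× (λ u → ψ (h u F.* z)))            ≈⟨ ΣF×-swap F (λ z u → ψ (h u F.* z)) ⟩
      ΣF× (λ u → ΣF× (λ z → ψ (h u F.* z)))            ≈⟨ ΣF×-cong (λ u _ → Σ×ψ (h u)) ⟩
      ΣF× (λ u → ifᵈ h u F.≟ F.0# then q-1 else K.- K.1#) ∎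
      where
      exponent-cong : ∀ z → Respects≈ (λ x → ψ ((x F.+ Y x z) F.+ z))
      exponent-cong z x≈x′ = ψ-cong (F.+-congʳ (F.+-cong x≈x′ (F.*-congʳ (F.*-congˡ (FP.pow-cong 3 x≈x′)))))

module CubicRoots {m : ℕ} (F : FiniteField (suc m)) (K : Char0Field) (t : FiniteField.Carrier F)
                  (t≉0 : ¬ (FiniteField._≈_ F t (FiniteField.0# F)))
                  (2≉0 : ¬ (FiniteField._≈_ F (cast (FiniteField.cring F) 2) (FiniteField.0# F)))
                  (3≉0 : ¬ (FiniteField._≈_ F (cast (FiniteField.cring F) 3) (FiniteField.0# F))) where
  private
    module F = FiniteField F
    module K = Char0Field K
    module FP = FieldProperties F.cring F.isField
    _^ᶠ_ : F.Carrier → ℕ → F.Carrier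
    x ^ᶠ k = pow F.cring x k
    [_] : ℕ → F.Carrier
    [ k ] = cast F.cring k
  open RingSums K.cring
  open OverField F

  4≉0 : ¬ ([ 4 ] F.≈ F.0#)
  4≉0 4≈0 = FP.*-nonzero 2≉0 2≉0 (F.trans (F.sym (FP.cast-* 2 2)) 4≈0)

  27≉0 : ¬ ([ 27 ] F.≈ F.0#)
  27≉0 27≈0 = FP.*-nonzero 3≉0 (FP.*-nonzero 3≉0 3≉0)
    (F.trans (F.*-congˡ (F.sym (FP.cast-* 3 3))) (F.trans (F.sym (FP.cast-* 3 9)) 27≈0))

  -- ε M⁻¹ t, written exactly as the argument of ω in Hq.
  c : F.Carrier
  c = ((F.- F.1#) F.* ([ 4 ] F.* F.inv [ 27 ])) F.* t

  c≉0 : ¬ (c F.≈ F.0#)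
  c≉0 = FP.*-nonzero (FP.*-nonzero FP.-1#≉0 (FP.*-nonzero 4≉0 (FP.inv-nonzero 27≉0))) t≉0

  -- Definitionally the polynomial whose roots Nf counts.
  f : F.Carrier → F.Carrier
  f x = (x ^ᶠ 3 F.+ ([ 3 ] F.* x ^ᶠ 2)) F.- ([ 4 ] F.* t)

  h : F.Carrier → F.Carrier
  h u = (F.1# F.+ u) F.+ c F.* u ^ᶠ 3

  f-0≉0 : ¬ (f F.0# F.≈ F.0#)
  f-0≉0 f0≈0 = FP.*-nonzero 4≉0 t≉0 (F.trans (F.sym (FP.-‿involutive _)) (F.trans (F.-‿cong -4t≈0) FP.-0#≈0#))
    where
    -4t≈0 : F.- ([ 4 ] F.* t) F.≈ F.0#
    -4t≈0 = F.trans (F.sym (F.+-identityˡ _))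
      (F.trans (F.+-congʳ (F.sym (F.trans (F.+-cong (F.zeroˡ _) (F.trans (F.*-congˡ (F.zeroˡ _)) (F.zeroʳ _)))
                                            (F.+-identityˡ _)))) f0≈0)

  f-rescaled : ∀ {u} → ¬ (u F.≈ F.0#) → f ([ 3 ] F.* F.inv u) F.* (u ^ᶠ 3 F.* F.inv [ 27 ]) F.≈ h u
  f-rescaled {u} u≉0 = begin
    f w F.* k                                                        ≈⟨ F.distribʳ _ _ _ ⟩
    (w ^ᶠ 3 F.+ [ 3 ] F.* w ^ᶠ 2) F.* k F.+ F.- ([ 4 ] F.* t) F.* k   ≈⟨ F.+-cong (F.distribʳ _ _ _) constant-term ⟩
    (w ^ᶠ 3 F.* k F.+ ([ 3 ] F.* w ^ᶠ 2) F.* k) F.+ c F.* u ^ᶠ 3      ≈⟨ F.+-congʳ (F.+-cong cubic-term quadratic-term) ⟩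
    h u                                                              ∎
    where
    open import Relation.Binary.Reasoning.Setoid F.setoid
    u⁻¹ w k : F.Carrier
    u⁻¹ = F.inv u
    w = [ 3 ] F.* u⁻¹
    k = u ^ᶠ 3 F.* F.inv [ 27 ]
    uu⁻¹≈1 : u F.* u⁻¹ F.≈ F.1#
    uu⁻¹≈1 = F.inv-r u u≉0
    27/27≈1 : ([ 3 ] F.* ([ 3 ] F.* [ 3 ])) F.* F.inv [ 27 ] F.≈ F.1#
    27/27≈1 = F.trans (F.*-congʳ (F.sym (F.trans (FP.cast-* 3 9) (F.*-congˡ (FP.cast-* 3 3))))) (F.inv-r _ 27≉0)
    cubic-term : w ^ᶠ 3 F.* k F.≈ F.1#
    cubic-term = F.trans
      (FP.solve 4 (λ a b x y →
          ((a FP.:* b) FP.:* ((a FP.:* b) FP.:* ((a FP.:* b) FP.:* FP.con 1))) FP.:* ((x FP.:* (x FP.:* (x FP.:* FP.con 1))) FP.:* y)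
          FP.:= ((a FP.:* (a FP.:* a)) FP.:* y) FP.:* ((x FP.:* b) FP.:* ((x FP.:* b) FP.:* (x FP.:* b))))
        F.refl [ 3 ] u⁻¹ u (F.inv [ 27 ]))
      (F.trans (F.*-cong 27/27≈1 (F.*-cong uu⁻¹≈1 (F.*-cong uu⁻¹≈1 uu⁻¹≈1)))
               (F.trans (F.*-identityˡ _) (F.trans (F.*-identityˡ _) (F.*-identityˡ _))))
    quadratic-term : ([ 3 ] F.* w ^ᶠ 2) F.* k F.≈ u
    quadratic-term = F.trans
      (FP.solve 4 (λ a b x y →
          (a FP.:* ((a FP.:* b) FP.:* ((a FP.:* b) FP.:* FP.con 1))) FP.:* ((x FP.:* (x FP.:* (x FP.:* FP.con 1))) FP.:* y)
          FP.:= ((a FP.:* (a FP.:* a)) FP.:* y) FP.:* (((x FP.:* b) FP.:* (x FP.:* b)) FP.:* x))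
        F.refl [ 3 ] u⁻¹ u (F.inv [ 27 ]))
      (F.trans (F.*-cong 27/27≈1 (F.*-congʳ (F.*-cong uu⁻¹≈1 uu⁻¹≈1)))
               (F.trans (F.*-identityˡ _) (F.trans (F.*-congʳ (F.*-identityˡ _)) (F.*-identityˡ _))))
    constant-term : F.- ([ 4 ] F.* t) F.* k F.≈ c F.* u ^ᶠ 3
    constant-term = F.sym (F.trans
      (FP.solve 5 (λ m f i t′ p → ((m FP.:* (f FP.:* i)) FP.:* t′) FP.:* p FP.:= m FP.:* ((f FP.:* t′) FP.:* (p FP.:* i)))
        F.refl (F.- F.1#) [ 4 ] (F.inv [ 27 ]) t (u ^ᶠ 3))
      (F.trans (FP.-1*x≈-x _) (FP.-‿distribˡ-* _ _)))

  σ : F.Carrier → F.Carrier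
  σ u = [ 3 ] F.* F.inv u

  σ-nonzero : ∀ u → ¬ (u F.≈ F.0#) → ¬ (σ u F.≈ F.0#)
  σ-nonzero u u≉0 = FP.*-nonzero 3≉0 (FP.inv-nonzero u≉0)

  σ-involutive : ∀ u → ¬ (u F.≈ F.0#) → σ (σ u) F.≈ u
  σ-involutive u u≉0 = F.trans (F.*-congˡ (F.sym inv-σ)) (F.trans (F.sym (F.*-assoc _ _ _))
                         (F.trans (F.*-congʳ (F.inv-r _ 3≉0)) (F.*-identityˡ u)))
    where
    inv-σ : F.inv [ 3 ] F.* u F.≈ F.inv (σ u)
    inv-σ = FP.inv-unique (σ-nonzero u u≉0)
      (F.trans (FP.solve 4 (λ a a⁻¹ b b⁻¹ → (a FP.:* b⁻¹) FP.:* (a⁻¹ FP.:* b) FP.:= (a FP.:* a⁻¹) FP.:* (b FP.:* b⁻¹))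
                 F.refl [ 3 ] (F.inv [ 3 ]) u (F.inv u))
        (F.trans (F.*-cong (F.inv-r _ 3≉0) (F.inv-r u u≉0)) (F.*-identityʳ _)))

  root-indicator : (F.Carrier → F.Carrier) → F.Carrier → K.Carrier
  root-indicator p x = ifᵈ p x F.≟ F.0# then K.1# else K.0#

  Nf≈Σ×[h≈0] : cast K.cring (Nf F t) K.≈ ΣF× (root-indicator h)
  Nf≈Σ×[h≈0] = begin
    cast K.cring (Nf F t)                   ≈⟨ cast-countFin F (suc m) (λ i → f (F.enum i)) ⟩
    ΣF (root-indicator f)                   ≈⟨ ΣF-splitAt F.0# (root-indicator f) (root-indicator-cong f f-cong) ⟩
    root-indicator f F.0# K.+ ΣF× (root-indicator f)
                                            ≈⟨ K.trans (K.+-congʳ (no-root-at-0 (f F.0# F.≟ F.0#))) (K.+-identityˡ _) ⟩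
    ΣF× (root-indicator f)                  ≈⟨ ΣF×-involution σ (λ u≈v → F.*-congˡ (F.inv-cong u≈v)) σ-nonzero σ-involutive
                                                 (root-indicator f) (root-indicator-cong f f-cong) ⟩
    ΣF× (λ u → root-indicator f (σ u))      ≈⟨ ΣF×-cong (λ u u≉0 → ifᵈ-cong K.setoid (_ F.≟ F.0#) (_ F.≟ F.0#)
                                                 (f-root⇒h-root u≉0) (h-root⇒f-root u≉0) K.refl K.refl) ⟩
    ΣF× (root-indicator h)                  ∎
    where
    open import Relation.Binary.Reasoning.Setoid K.setoid
    f-cong : ∀ {x y} → x F.≈ y → f x F.≈ f y
    f-cong x≈y = F.+-congʳ (F.+-cong (FP.pow-cong 3 x≈y) (F.*-congˡ (FP.pow-cong 2 x≈y)))
    root-indicator-cong : ∀ p → (∀ {x y} → x F.≈ y → p x F.≈ p y) → Respects≈ (root-indicator p)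
    root-indicator-cong p p-cong x≈y = ifᵈ≟-cong (p-cong x≈y) K.refl K.refl
    no-root-at-0 : (d : Dec (f F.0# F.≈ F.0#)) → (ifᵈ d then K.1# else K.0#) K.≈ K.0#
    no-root-at-0 (yes f0≈0) = ⊥-elim (f-0≉0 f0≈0)
    no-root-at-0 (no _)     = K.refl
    f-root⇒h-root : ∀ {u} → ¬ (u F.≈ F.0#) → f (σ u) F.≈ F.0# → h u F.≈ F.0#
    f-root⇒h-root u≉0 fσu≈0 = F.trans (F.sym (f-rescaled u≉0)) (F.trans (F.*-congʳ fσu≈0) (F.zeroˡ _))
    h-root⇒f-root : ∀ {u} → ¬ (u F.≈ F.0#) → h u F.≈ F.0# → f (σ u) F.≈ F.0#
    h-root⇒f-root u≉0 hu≈0 = FP.x≉0∧x*y≈0⇒y≈0 (FP.*-nonzero (FP.pow-nonzero 3 u≉0) (FP.inv-nonzero 27≉0))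
      (F.trans (F.*-comm _ _) (F.trans (f-rescaled u≉0) hu≈0))

module _ (K : Char0Field) where
  open Char0Field K
  open FieldProperties cring isField
  open import Relation.Binary.Reasoning.Setoid setoid

  [-1]³/[1-[1+C]]≈C⁻¹ : ∀ {C} → ¬ (C ≈ 0#) → pow cring (- 1#) 3 * inv (1# - (1# + C)) ≈ inv C
  [-1]³/[1-[1+C]]≈C⁻¹ {C} C≉0 = begin
    pow cring (- 1#) 3 * inv (1# - (1# + C)) ≈⟨ *-cong -1³≈-1 (inv-cong 1-[1+C]≈-C) ⟩
    - 1# * inv (- C)                         ≈⟨ *-congˡ (sym -C⁻¹≈[-C]⁻¹) ⟩
    - 1# * - inv C                           ≈⟨ -1*x≈-x _ ⟩
    - - inv C                                ≈⟨ -‿involutive _ ⟩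
    inv C                                    ∎
    where
    -1³≈-1 : pow cring (- 1#) 3 ≈ - 1#
    -1³≈-1 = trans (*-congˡ (trans (*-congˡ (*-identityʳ _)) (trans (-1*x≈-x _) (-‿involutive _)))) (*-identityʳ _)
    1-[1+C]≈-C : 1# - (1# + C) ≈ - C
    1-[1+C]≈-C = trans (+-congˡ (sym (-‿+-comm _ _))) (trans (sym (+-assoc _ _ _))
                   (trans (+-congʳ (-‿inverseʳ _)) (+-identityˡ _)))
    -C⁻¹≈[-C]⁻¹ : - inv C ≈ inv (- C)
    -C⁻¹≈[-C]⁻¹ = inv-unique (λ -C≈0 → C≉0 (trans (sym (-‿involutive C)) (trans (-‿cong -C≈0) -0#≈0#)))
      (trans (sym (-‿distribˡ-* _ _)) (trans (-‿cong (sym (-‿distribʳ-* _ _))) (trans (-‿involutive _) (inv-r C C≉0))))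

  hypergeometric-normalisation : ∀ {C N S R E} → ¬ (C ≈ 0#) → ¬ (1# + C ≈ 0#) →
    S ≈ (1# + C) * N + - C → R ≈ C * S + 1# → E ≈ - 1# + inv (1# + C) * R →
    N ≈ 1# + (pow cring (- 1#) 3 * inv (1# - (1# + C))) * E
  hypergeometric-normalisation {C} {N} {S} {R} {E} C≉0 Q≉0 S≈ R≈ E≈ = begin
    N                                                     ≈⟨ N≈M+1 ⟩
    M + 1#                                                ≈⟨ +-comm _ _ ⟩
    1# + M                                                ≈⟨ +-congˡ (sym C⁻¹[CM]≈M) ⟩
    1# + inv C * (C * M)                                  ≈⟨ +-congˡ (sym (*-cong ([-1]³/[1-[1+C]]≈C⁻¹ C≉0) E≈CM)) ⟩
    1# + (pow cring (- 1#) 3 * inv (1# - (1# + C))) * E   ∎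
    where
    M : Carrier
    M = N - 1#
    N≈M+1 : N ≈ M + 1#
    N≈M+1 = x-z≈y⇒x≈y+z refl
    S≈M+1+CM : S ≈ (M + 1#) + C * M
    S≈M+1+CM = trans S≈ (x≈y+z⇒x-z≈y (begin
      (1# + C) * N                 ≈⟨ *-congˡ N≈M+1 ⟩
      (1# + C) * (M + 1#)          ≈⟨ solve 2 (λ c m → (con 1 :+ c) :* (m :+ con 1) := ((m :+ con 1) :+ c :* m) :+ c) refl C M ⟩
      ((M + 1#) + C * M) + C       ∎))
    Q⁻¹R≈CM+1 : inv (1# + C) * R ≈ C * M + 1#
    Q⁻¹R≈CM+1 = begin
      inv (1# + C) * R                             ≈⟨ *-congˡ (trans R≈ (+-congʳ (*-congˡ S≈M+1+CM))) ⟩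
      inv (1# + C) * (C * ((M + 1#) + C * M) + 1#) ≈⟨ *-congˡ (solve 2 (λ c m → c :* ((m :+ con 1) :+ c :* m) :+ con 1
                                                                   := (con 1 :+ c) :* (c :* m :+ con 1)) refl C M) ⟩
      inv (1# + C) * ((1# + C) * (C * M + 1#))     ≈⟨ sym (*-assoc _ _ _) ⟩
      (inv (1# + C) * (1# + C)) * (C * M + 1#)     ≈⟨ *-congʳ (inverseˡ _ Q≉0) ⟩
      1# * (C * M + 1#)                            ≈⟨ *-identityˡ _ ⟩
      C * M + 1#                                   ∎
    E≈CM : E ≈ C * M
    E≈CM = trans E≈ (trans (+-congˡ Q⁻¹R≈CM+1) (trans (+-comm _ _) (x≈y+z⇒x-z≈y refl)))
    C⁻¹[CM]≈M : inv C * (C * M) ≈ M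
    C⁻¹[CM]≈M = trans (sym (*-assoc _ _ _)) (trans (*-congʳ (inverseˡ C C≉0)) (*-identityˡ M))

module RootCount {n : ℕ} (F : FiniteField (suc (suc n))) (K : Char0Field) (Ψ : AddChar F K) (Ω : GenMulChar F K)
                  (t : FiniteField.Carrier F) (t≉0 : ¬ (FiniteField._≈_ F t (FiniteField.0# F)))
                  (2≉0 : ¬ (FiniteField._≈_ F (cast (FiniteField.cring F) 2) (FiniteField.0# F)))
                  (3≉0 : ¬ (FiniteField._≈_ F (cast (FiniteField.cring F) 3) (FiniteField.0# F))) where
  private
    module F = FiniteField F
    module K = Char0Field K
    module KP = FieldProperties K.cring K.isField
  open AddChar Ψ
  open GenMulChar Ω
  open CubicRoots F K t t≉0 2≉0 3≉0 using (c; c≉0; root-indicator; Nf≈Σ×[h≈0])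
  open GaussSums F K Ψ Ω
  open MultiplicativeCharacter F K Ω using (q-1; q-1≉0; Σ×1≈q-1; _^_)
  open RingSums K.cring
  open OverField F
  open import Relation.Binary.Reasoning.Setoid K.setoid

  Q : K.Carrier
  Q = cast K.cring (suc (suc n))

  qPowS-0 : qPowS F K Ψ Ω 0 K.≈ K.1#
  qPowS-0 with suc n ∣? 0
  ... | yes _   = K.refl
  ... | no  q-1∤0 = ⊥-elim (q-1∤0 (suc n ∣0))

  qPowS-suc : ∀ j → suc j < suc n → qPowS F K Ψ Ω (suc j) K.≈ K.inv Q
  qPowS-suc j j<n with suc n ∣? suc j
  ... | yes q-1∣j = ⊥-elim (ℕ.<⇒≱ j<n (∣⇒≤ q-1∣j))
  ... | no  _     = K.refl

  A-0 : A c c≉0 0 K.≈ K.- K.1#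
  A-0 = K.trans (K.*-identityʳ _) (K.trans (K.*-cong (K.trans (K.*-cong g-0 g-0) -1²≈1) g-0) (K.*-identityˡ _))
    where
    -1²≈1 : K.- K.1# K.* K.- K.1# K.≈ K.1#
    -1²≈1 = K.trans (KP.-1*x≈-x _) (KP.-‿involutive _)

  -- Verbatim the summand of Hq, so that Hq unfolds to a prefactor times Σ (suc n) summand.
  summand : Fin (suc n) → K.Carrier
  summand i = qPowS F K Ψ Ω (toℕ i) K.* g (+ (3 *ℕ toℕ i)) K.* g (-ℤ (+ toℕ i)) K.* g (-ℤ (+ (2 *ℕ toℕ i))) K.* ω c ^ toℕ i

  summand≈ : ∀ i → summand i K.≈ qPowS F K Ψ Ω (toℕ i) K.* A c c≉0 (toℕ i)
  summand≈ i = KP.solve 5 (λ a b d e f → (((a KP.:* b) KP.:* d) KP.:* e) KP.:* f KP.:= a KP.:* (((b KP.:* d) KP.:* e) KP.:* f))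
                 K.refl _ _ _ _ _

  R : K.Carrier
  R = Σ n (λ j → A c c≉0 (suc (toℕ j)))

  Σsummand≈ : Σ (suc n) summand K.≈ K.- K.1# K.+ K.inv Q K.* R
  Σsummand≈ = K.+-cong (K.trans (summand≈ fzero) (K.trans (K.*-cong qPowS-0 A-0) (K.*-identityˡ _)))
    (K.trans (Σ-cong n (λ j → K.trans (summand≈ (fsuc j)) (K.*-congʳ (qPowS-suc (toℕ j) (s≤s (toℕ<n j))))))
             (K.sym (*-distribˡ-Σ n (K.inv Q) (λ j → A c c≉0 (suc (toℕ j))))))

  S : K.Carrier
  S = ΣF× (λ z → ΣF× (λ x → ψ ((x F.+ Y c c≉0 x z) F.+ z)))

  R≈ : R K.≈ q-1 K.* S K.+ K.1#
  R≈ = KP.x-z≈y⇒x≈y+z (K.trans (K.+-comm _ _) (K.trans (K.+-congʳ (K.sym A-0)) (ΣA≈ c c≉0)))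

  S≈ : S K.≈ Q K.* cast K.cring (Nf F t) K.+ K.- q-1
  S≈ = begin
    S                                                             ≈⟨ Σ×Σ×ψ-constrained c c≉0 ⟩
    ΣF× (λ u → ifᵈ h c c≉0 u F.≟ F.0# then q-1 else K.- K.1#)     ≈⟨ ΣF×-cong (λ u _ → split (h c c≉0 u F.≟ F.0#)) ⟩
    ΣF× (λ u → Q K.* root-indicator (h c c≉0) u K.+ K.- K.1#)    ≈⟨ ΣF×-distrib (λ u → Q K.* root-indicator (h c c≉0) u) (λ _ → K.- K.1#) ⟩
    ΣF× (λ u → Q K.* root-indicator (h c c≉0) u) K.+ ΣF× (λ _ → K.- K.1#)
                                                                  ≈⟨ K.+-cong (K.sym (*-distribˡ-ΣF× F Q (root-indicator (h c c≉0)))) -Σ×1≈-q-1 ⟩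
    Q K.* ΣF× (root-indicator (h c c≉0)) K.+ K.- q-1              ≈⟨ K.+-congʳ (K.*-congˡ (K.sym Nf≈Σ×[h≈0])) ⟩
    Q K.* cast K.cring (Nf F t) K.+ K.- q-1                       ∎
    where
    split : ∀ {P : Set} (d : Dec P) → (ifᵈ d then q-1 else K.- K.1#) K.≈ Q K.* (ifᵈ d then K.1# else K.0#) K.+ K.- K.1#
    split (yes _) = K.sym (K.trans (K.+-congʳ (K.trans (K.*-identityʳ Q) (K.+-comm _ _))) (KP.x≈y+z⇒x-z≈y K.refl))
    split (no  _) = K.sym (K.trans (K.+-congʳ (K.zeroʳ Q)) (K.+-identityˡ _))
    -Σ×1≈-q-1 : ΣF× (λ _ → K.- K.1#) K.≈ K.- q-1
    -Σ×1≈-q-1 = K.trans (ΣF×-cong (λ _ _ → K.sym (K.*-identityʳ _)))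
      (K.trans (K.sym (*-distribˡ-ΣF× F (K.- K.1#) (λ _ → K.1#))) (K.trans (K.*-congˡ Σ×1≈q-1) (KP.-1*x≈-x q-1)))

  Nf≈1+Hq : cast K.cring (Nf F t) K.≈ K.1# K.+ Hq F K Ψ Ω t
  Nf≈1+Hq = hypergeometric-normalisation K q-1≉0 (K.char0 (suc n)) S≈ R≈ Σsummand≈

corollary1p6 : (q : ℕ) (F : FiniteField q) → ¬ (2 ∣ q) → ¬ (3 ∣ q) →
    (K : Char0Field) (Ψ : AddChar F K) (Ω : GenMulChar F K) →
    (t : FiniteField.Carrier F) →
    ¬ (FiniteField._≈_ F t (FiniteField.0# F)) →
    ¬ (FiniteField._≈_ F t (FiniteField.1# F)) →
    Char0Field._≈_ K (cast (Char0Field.cring K) (Nf F t))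
    (Char0Field._+_ K (Char0Field.1# K) (Hq F K Ψ Ω t))
corollary1p6 zero F _ _ _ _ _ _ _ _ with () ← proj₁ (FiniteField.enum-sur F (FiniteField.0# F))
corollary1p6 (suc zero) F _ _ _ _ _ _ _ _
  with fzero , enum0≈0 ← FiniteField.enum-sur F (FiniteField.0# F)
     | fzero , enum0≈1 ← FiniteField.enum-sur F (FiniteField.1# F)
  = ⊥-elim (FiniteField.1≉0 F (FiniteField.trans F (FiniteField.sym F enum0≈1) enum0≈0))
corollary1p6 (suc (suc n)) F 2∤q 3∤q K Ψ Ω t t≉0 _ =
  RootCount.Nf≈1+Hq F K Ψ Ω t t≉0 (prime∤size⇒cast≉0 prime[2] 2∤q) (prime∤size⇒cast≉0 (from-yes (prime? 3)) 3∤q)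
  where open FiniteFieldProperties F
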